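{- For all positive integers $n$ and $j$, \[ \sum_{k=0}^n\binom{n}{k}\frac{2^k}{k+1}\left((-1)^k\frac{F_{j(k+1)}}{L_j^k}\Big(\frac{L_j}{\sqrt5F_j}\Big)^n-(1+(-1)^n)\frac{2^{k+3}-2}{k+2}F_jB_{k+2}\right)=0, \] and in particular \[ \sum_{k=1}^{2n}(-1)^k\binom{2n-1}{k-1}\frac{2^kF_{jk}}{kL_j^k}=0. \] Similarly, \[ \sum_{k=0}^n\binom{n}{k}2^k\left((-1)^k\frac{L_{jk}}{L_j^k}\Big(\frac{L_j}{\sqrt5F_j}\Big)^n-\frac{1+(-1)^n}{n-k+1}B_k\right)=1+(-1)^n, \] and \[ \sum_{k=0}^{2n-1}(-1)^k\binom{2n-1}{k}\frac{2^kL_{jk}}{L_j^k}=0. \]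
   Context: $F_n$ and $L_n$ denote the Fibonacci and Lucas numbers: $F_0=0,F_1=1$, $L_0=2,L_1=1$, and $u_n=u_{n-1}+u_{n-2}$. The Bernoulli numbers $B_n$ are defined by $\sum_{n\ge0}B_n\frac{z^n}{n!}=\frac{z}{e^z-1}$ (so $B_0=1$, $B_1=-\tfrac12$, $B_2=\tfrac16$, $B_{2n+1}=0$ for $n\ge1$). -}

module Defs where

open import Data.Nat as ℕ using (ℕ; zero; suc)
open import Data.Nat.Combinatorics using (_C_)
open import Data.Integer as ℤ using (ℤ)
open import Data.Rational as ℚ using (ℚ; 0ℚ; 1ℚ; _+_; _*_; _-_; -_; _÷_)
open import Data.Rational.Properties using (_≟_)
open import Relation.Nullary using (yes; no)

fib : ℕ → ℕ
fib 0 = 0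
fib 1 = 1
fib (suc (suc n)) = fib (suc n) ℕ.+ fib n

luc : ℕ → ℕ
luc 0 = 2
luc 1 = 1
luc (suc (suc n)) = luc (suc n) ℕ.+ luc n

nℚ : ℕ → ℚ
nℚ n = ℤ.+ n ℚ./ 1

-- total reciprocal on ℚ (inv 0 = 0); only ever applied to nonzero values here
inv : ℚ → ℚ
inv q with q ≟ 0ℚ
... | yes _ = 0ℚ
... | no q≢0 = _÷_ 1ℚ q {{ℚ.≢-nonZero q≢0}}

_^ℚ_ : ℚ → ℕ → ℚ
q ^ℚ zero = 1ℚ
q ^ℚ suc n = q * (q ^ℚ n)

sgn : ℕ → ℚ
sgn k = (- 1ℚ) ^ℚ k

sumN : ℕ → ℕ → (ℕ → ℚ) → ℚ
sumN a zero f = 0ℚ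
sumN a (suc len) f = f a + sumN (suc a) len f

-- Σ_{k = a}^{b} f k  (empty when b < a)
Σℚ[_,_] : ℕ → ℕ → (ℕ → ℚ) → ℚ
Σℚ[ a , b ] f = sumN a (suc b ℕ.∸ a) f

-- Bernoulli numbers, from the generating function z/(e^z-1) = Σ B_n z^n/n!:
-- comparing coefficients in (Σ B_n z^n/n!)(e^z-1)/z = 1 gives
-- Σ_{k=0}^{m} C(m+1,k) B_k = [m = 0], i.e.
-- B_0 = 1,  B_m = -(1/(m+1)) Σ_{k=0}^{m-1} C(m+1,k) B_k.
-- bernUpTo m returns the function k ↦ B_k, valid for k ≤ m.
bernUpTo : ℕ → (ℕ → ℚ)
bernUpTo zero k = 1ℚ
bernUpTo (suc m) k with k ℕ.≤? m
... | yes _ = bernUpTo m k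
... | no _ = - (inv (nℚ (suc (suc m))) *
               Σℚ[ 0 , m ] (λ i → nℚ (suc (suc m) C i) * bernUpTo m i))

bernoulli : ℕ → ℚ
bernoulli m = bernUpTo m m

-- ℚ(√5): pairs a + b√5 with a, b rational (a subfield of ℝ)
record Q5 : Set where
  constructor q5
  field
    re : ℚ
    ir : ℚ
open Q5 public

ι : ℚ → Q5
ι q = q5 q 0ℚ

√5 : Q5
√5 = q5 0ℚ 1ℚ

_⊕_ : Q5 → Q5 → Q5
q5 a b ⊕ q5 c d = q5 (a + c) (b + d)

_⊖_ : Q5 → Q5 → Q5
q5 a b ⊖ q5 c d = q5 (a - c) (b - d)

_⊗_ : Q5 → Q5 → Q5
q5 a b ⊗ q5 c d = q5 (a * c + nℚ 5 * (b * d)) (a * d + b * c)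

-- total inverse in ℚ(√5): (a + b√5)⁻¹ = (a - b√5)/(a² - 5b²)  (0⁻¹ = 0)
inv5 : Q5 → Q5
inv5 (q5 a b) = let n = inv (a * a - nℚ 5 * (b * b)) in q5 (a * n) ((- b) * n)

_^5_ : Q5 → ℕ → Q5
x ^5 zero = ι 1ℚ
x ^5 suc n = x ⊗ (x ^5 n)

Σ5[_,_] : ℕ → ℕ → (ℕ → Q5) → Q5
Σ5[ a , b ] f = go a (suc b ℕ.∸ a)
  where
  go : ℕ → ℕ → Q5
  go a zero = ι 0ℚ
  go a (suc len) = f a ⊕ go (suc a) len

open import Relation.Binary.PropositionalEquality using (_≡_; refl)
_ : bernoulli 2 ≡ (ℤ.+ 1 ℚ./ 6)
_ = refl
_ : bernoulli 4 ≡ (ℤ.- (ℤ.+ 1) ℚ./ 30)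
_ = refl
_ : bernoulli 3 ≡ 0ℚ
_ = refl
_ : bernoulli 1 ≡ (ℤ.- (ℤ.+ 1) ℚ./ 2)
_ = refl
_ : (√5 ⊗ √5) ≡ ι (nℚ 5)
_ = refl

module Submission where

-- Put α = φ^j, β = ψ^j and t = -2/L_j.  Since α + β = L_j and α - β = √5 F_j, one has
-- 1 + tα = -u and 1 + tβ = u with u = √5 F_j/L_j, so by Binet's formula and the binomial
-- theorem, in ℚ(√5),
--   Σ_k C(N,k) t^k L_{jk} = ((-1)^N + 1) u^N   and   √5 Σ_k C(N,k) t^k F_{jk} = ((-1)^N - 1) u^N;
-- division by k + 1 is absorbed by C(N,k)/(k+1) = C(N+1,k+1)/(N+1).  This evaluates the
-- Fibonacci and Lucas halves of all four identities.  The Bernoulli halves carry the factor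
-- 1 + (-1)^n, and for even n they reduce to Σ_k C(m,k) 2^k B_k = 0 for odd m and
-- Σ_k C(m,k) (4^k - 2^k) B_k = 0 for even m.  These are parity statements about the formal
-- power series B(2z) e^z = z / sinh z and (B(2z) - B(4z)) e^z = z / cosh z, where
-- B(z) = z/(e^z - 1) is handled through its defining relation B(z) (e^z - 1) = z.

open import Level using (0ℓ)
open import Algebra.Bundles using (CommutativeRing)
open import Algebra.Structures using (IsCommutativeRing)
open import Algebra.Solver.Ring.AlmostCommutativeRing using (fromCommutativeRing)
import Algebra.Solver.Ring.Simple
open import Data.Empty using (⊥-elim)
open import Data.Fin using (toℕ)
import Data.Integer as ℤ
import Data.Integer.Properties as ℤ
open import Data.Nat as ℕ using (ℕ; zero; suc; _∸_; _<_; _≤_; z≤n; s≤s; _!)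
import Data.Nat.Properties as ℕ
import Data.Nat.GCD as ℕ
open import Data.Nat.Combinatorics using (_C_; nCk≡n!/k![n-k]!; k![n∸k]!∣n!; nCk≡nC[n∸k]; nC1≡n; nCn≡1)
open import Data.Nat.DivMod using (m/n*n≡m)
open import Data.Nat.Induction using (<-rec)
open import Data.Nat.Tactic.RingSolver using (solve-∀)
open import Data.Product as Product using (Σ; _,_)
open import Data.Rational.Properties as ℚ using (+-*-commutativeRing)
open import Data.Rational.Solver using (module +-*-Solver)
import Data.Rational.Unnormalised as ℚᵘ
import Data.Rational.Unnormalised.Properties as ℚᵘ
open import Data.Sum using (_⊎_; inj₁; inj₂)
open import Relation.Binary.Bundles using (Setoid)
open import Relation.Binary.PropositionalEquality as ≡ using (_≡_; _≢_; _≗_)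
import Relation.Binary.Reasoning.Setoid
open import Relation.Nullary using (Dec; yes; no)
open import Defs

-- Finite sums in a commutative ring

module CommutativeRingSums (R : CommutativeRing 0ℓ 0ℓ) where

  open CommutativeRing R
  open import Relation.Binary.Reasoning.Setoid setoid
  open import Algebra.Properties.Ring ring using (-1*x≈-x)
  open import Algebra.Properties.Monoid.Mult +-monoid public using (_×_)
  open import Algebra.Properties.Semiring.Exp semiring public using (_^_; ^-homo-*; ^-assocʳ)
  open import Algebra.Properties.CommutativeSemiring.Exp commutativeSemiring public using (^-distrib-*)
  open import Algebra.Properties.Monoid.Sum +-monoid using (sum)
  import Algebra.Properties.CommutativeSemiring.Binomial commutativeSemiring as Binomial

  1^n≈1 : ∀ n → 1# ^ n ≈ 1#
  1^n≈1 zero = refl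
  1^n≈1 (suc n) = trans (*-identityˡ _) (1^n≈1 n)

  Σ< : ℕ → (ℕ → Carrier) → Carrier
  Σ< zero f = 0#
  Σ< (suc n) f = Σ< n f + f n

  Σ-cong : ∀ n {f g : ℕ → Carrier} → (∀ k → k < n → f k ≈ g k) → Σ< n f ≈ Σ< n g
  Σ-cong zero e = refl
  Σ-cong (suc n) e = +-cong (Σ-cong n (λ k k<n → e k (ℕ.m<n⇒m<1+n k<n))) (e n ℕ.≤-refl)

  Σ-cong′ : ∀ n {f g : ℕ → Carrier} → (∀ k → f k ≈ g k) → Σ< n f ≈ Σ< n g
  Σ-cong′ n e = Σ-cong n (λ k _ → e k)

  Σ-zero : ∀ n {f : ℕ → Carrier} → (∀ k → k < n → f k ≈ 0#) → Σ< n f ≈ 0#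
  Σ-zero zero e = refl
  Σ-zero (suc n) e =
    trans (+-cong (Σ-zero n (λ k k<n → e k (ℕ.m<n⇒m<1+n k<n))) (e n ℕ.≤-refl)) (+-identityˡ 0#)

  Σ-distrib-+ : ∀ n (f g : ℕ → Carrier) → Σ< n (λ k → f k + g k) ≈ Σ< n f + Σ< n g
  Σ-distrib-+ zero f g = sym (+-identityˡ 0#)
  Σ-distrib-+ (suc n) f g = begin
    Σ< n (λ k → f k + g k) + (f n + g n)  ≈⟨ +-congʳ (Σ-distrib-+ n f g) ⟩
    Σ< n f + Σ< n g + (f n + g n)         ≈⟨ +-assoc _ _ _ ⟩
    Σ< n f + (Σ< n g + (f n + g n))       ≈⟨ +-congˡ (trans (+-comm _ _) (trans (+-assoc _ _ _) (+-congˡ (+-comm _ _)))) ⟩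
    Σ< n f + (f n + (Σ< n g + g n))       ≈⟨ +-assoc _ _ _ ⟨
    Σ< n f + f n + (Σ< n g + g n)         ∎

  *-distribˡ-Σ : ∀ n c (f : ℕ → Carrier) → c * Σ< n f ≈ Σ< n (λ k → c * f k)
  *-distribˡ-Σ zero c f = zeroʳ c
  *-distribˡ-Σ (suc n) c f = trans (distribˡ c _ _) (+-congʳ (*-distribˡ-Σ n c f))

  *-distribʳ-Σ : ∀ n c (f : ℕ → Carrier) → Σ< n f * c ≈ Σ< n (λ k → f k * c)
  *-distribʳ-Σ n c f = trans (*-comm _ c) (trans (*-distribˡ-Σ n c f) (Σ-cong′ n (λ k → *-comm c (f k))))

  Σ-neg : ∀ n (f : ℕ → Carrier) → Σ< n (λ k → - f k) ≈ - Σ< n f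
  Σ-neg n f = begin
    Σ< n (λ k → - f k)        ≈⟨ Σ-cong′ n (λ k → -1*x≈-x (f k)) ⟨
    Σ< n (λ k → - 1# * f k)   ≈⟨ *-distribˡ-Σ n (- 1#) f ⟨
    - 1# * Σ< n f             ≈⟨ -1*x≈-x _ ⟩
    - Σ< n f                  ∎

  Σ-distrib-- : ∀ n (f g : ℕ → Carrier) → Σ< n (λ k → f k - g k) ≈ Σ< n f - Σ< n g
  Σ-distrib-- n f g = trans (Σ-distrib-+ n f (λ k → - g k)) (+-congˡ (Σ-neg n g))

  Σ-head : ∀ n (f : ℕ → Carrier) → Σ< (suc n) f ≈ f 0 + Σ< n (λ k → f (suc k))
  Σ-head zero f = trans (+-identityˡ _) (sym (+-identityʳ _))
  Σ-head (suc n) f = trans (+-congʳ (Σ-head n f)) (+-assoc _ _ _)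

  sum∘toℕ≈Σ : ∀ n (f : ℕ → Carrier) → sum {n} (λ i → f (toℕ i)) ≈ Σ< n f
  sum∘toℕ≈Σ zero f = refl
  sum∘toℕ≈Σ (suc n) f = trans (+-congˡ (sum∘toℕ≈Σ n (λ k → f (suc k)))) (sym (Σ-head n f))

  binomial-theorem : ∀ n x y → Σ< (suc n) (λ k → (n C k) × (x ^ k * y ^ (n ∸ k))) ≈ (x + y) ^ n
  binomial-theorem n x y =
    trans (sym (sum∘toℕ≈Σ (suc n) (λ k → (n C k) × (x ^ k * y ^ (n ∸ k))))) (sym (Binomial.theorem n x y))


-- Rational arithmetic

open import Data.Rational as ℚ using (ℚ; 0ℚ; 1ℚ; _+_; _*_; _-_; -_)
open CommutativeRingSums +-*-commutativeRing renaming (_×_ to _×ℚ_)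

nℚ-suc : ∀ n → nℚ (suc n) ≡ 1ℚ + nℚ n
nℚ-suc n = ℚ.toℚᵘ-injective (begin
  ℚ.toℚᵘ (nℚ (suc n))                              ≈⟨ ℚ.toℚᵘ-fromℚᵘ (ℚᵘ.mkℚᵘ (ℤ.+ suc n) 0) ⟩
  ℚᵘ.mkℚᵘ (ℤ.+ suc n) 0                             ≈⟨ ℚᵘ.*≡* numerators ⟩
  ℚᵘ.mkℚᵘ (ℤ.+ 1) 0 ℚᵘ.+ ℚᵘ.mkℚᵘ (ℤ.+ n) 0          ≈⟨ ℚᵘ.+-cong (ℚ.toℚᵘ-fromℚᵘ (ℚᵘ.mkℚᵘ (ℤ.+ 1) 0)) (ℚ.toℚᵘ-fromℚᵘ (ℚᵘ.mkℚᵘ (ℤ.+ n) 0)) ⟨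
  ℚ.toℚᵘ 1ℚ ℚᵘ.+ ℚ.toℚᵘ (nℚ n)                     ≈⟨ ℚ.toℚᵘ-homo-+ 1ℚ (nℚ n) ⟨
  ℚ.toℚᵘ (1ℚ + nℚ n)                               ∎)
  where
  open import Relation.Binary.Reasoning.Setoid ℚᵘ.≃-setoid
  numerators : ℤ.+ suc n ℤ.* ℤ.+ 1 ≡ (ℤ.+ 1 ℤ.+ ℤ.+ n ℤ.* ℤ.+ 1) ℤ.* ℤ.+ 1
  numerators = ≡.trans (ℤ.*-identityʳ _)
    (≡.sym (≡.trans (ℤ.*-identityʳ _) (≡.cong (λ z → ℤ.+ 1 ℤ.+ z) (ℤ.*-identityʳ (ℤ.+ n)))))

nℚ-+ : ∀ m n → nℚ (m ℕ.+ n) ≡ nℚ m + nℚ n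
nℚ-+ zero n = ≡.sym (ℚ.+-identityˡ (nℚ n))
nℚ-+ (suc m) n = begin
  nℚ (suc (m ℕ.+ n))     ≡⟨ nℚ-suc (m ℕ.+ n) ⟩
  1ℚ + nℚ (m ℕ.+ n)      ≡⟨ ≡.cong (1ℚ +_) (nℚ-+ m n) ⟩
  1ℚ + (nℚ m + nℚ n)     ≡⟨ ℚ.+-assoc 1ℚ (nℚ m) (nℚ n) ⟨
  1ℚ + nℚ m + nℚ n       ≡⟨ ≡.cong (_+ nℚ n) (nℚ-suc m) ⟨
  nℚ (suc m) + nℚ n      ∎
  where open ≡.≡-Reasoning

nℚ-* : ∀ m n → nℚ (m ℕ.* n) ≡ nℚ m * nℚ n
nℚ-* zero n = ≡.sym (ℚ.*-zeroˡ (nℚ n))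
nℚ-* (suc m) n = begin
  nℚ (n ℕ.+ m ℕ.* n)     ≡⟨ nℚ-+ n (m ℕ.* n) ⟩
  nℚ n + nℚ (m ℕ.* n)    ≡⟨ ≡.cong (nℚ n +_) (nℚ-* m n) ⟩
  nℚ n + nℚ m * nℚ n     ≡⟨ solve 2 (λ a b → a :+ b :* a := (con 1ℚ :+ b) :* a) ≡.refl (nℚ n) (nℚ m) ⟩
  (1ℚ + nℚ m) * nℚ n     ≡⟨ ≡.cong (_* nℚ n) (nℚ-suc m) ⟨
  nℚ (suc m) * nℚ n      ∎
  where
  open ≡.≡-Reasoning
  open +-*-Solver

nℚ-^ : ∀ m n → nℚ (m ℕ.^ n) ≡ nℚ m ^ n
nℚ-^ m zero = ≡.refl
nℚ-^ m (suc n) = ≡.trans (nℚ-* m (m ℕ.^ n)) (≡.cong (nℚ m *_) (nℚ-^ m n))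

×ℚ≡nℚ* : ∀ n q → n ×ℚ q ≡ nℚ n * q
×ℚ≡nℚ* zero q = ≡.sym (ℚ.*-zeroˡ q)
×ℚ≡nℚ* (suc n) q = begin
  q + n ×ℚ q          ≡⟨ ≡.cong (q +_) (×ℚ≡nℚ* n q) ⟩
  q + nℚ n * q        ≡⟨ solve 2 (λ q a → q :+ a :* q := (con 1ℚ :+ a) :* q) ≡.refl q (nℚ n) ⟩
  (1ℚ + nℚ n) * q     ≡⟨ ≡.cong (_* q) (nℚ-suc n) ⟨
  nℚ (suc n) * q      ∎
  where
  open ≡.≡-Reasoning
  open +-*-Solver

^ℚ≡^ : ∀ q n → q ^ℚ n ≡ q ^ n
^ℚ≡^ q zero = ≡.refl
^ℚ≡^ q (suc n) = ≡.cong (q *_) (^ℚ≡^ q n)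

sumN≡Σ : ∀ a len (f : ℕ → ℚ) → sumN a len f ≡ Σ< len (λ k → f (a ℕ.+ k))
sumN≡Σ a zero f = ≡.refl
sumN≡Σ a (suc len) f = begin
  f a + sumN (suc a) len f                         ≡⟨ ≡.cong (f a +_) (sumN≡Σ (suc a) len f) ⟩
  f a + Σ< len (λ k → f (suc a ℕ.+ k))
    ≡⟨ ≡.cong₂ _+_ (≡.cong f (ℕ.+-identityʳ a)) (Σ-cong′ len (λ k → ≡.cong f (ℕ.+-suc a k))) ⟨
  f (a ℕ.+ 0) + Σ< len (λ k → f (a ℕ.+ suc k))     ≡⟨ Σ-head len (λ k → f (a ℕ.+ k)) ⟨
  Σ< (suc len) (λ k → f (a ℕ.+ k))                 ∎
  where open ≡.≡-Reasoning

nℚ-injective : ∀ {m n} → nℚ m ≡ nℚ n → m ≡ n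
nℚ-injective {m} {n} eq = ℤ.+-injective (≡.trans (≡.sym (↥nℚ m)) (≡.trans (≡.cong ℚ.↥_ eq) (↥nℚ n)))
  where
  ↥nℚ : ∀ a → ℚ.↥ (nℚ a) ≡ ℤ.+ a
  ↥nℚ a = ≡.trans (≡.sym (ℤ.*-identityʳ _))
    (≡.trans (≡.cong (λ g → ℚ.↥ (nℚ a) ℤ.* ℤ.+ g) (≡.sym (ℕ.gcd-zeroʳ a))) (ℚ.↥-/ (ℤ.+ a) 1))

nℚ≢0 : ∀ {n} → 1 ≤ n → nℚ n ≢ 0ℚ
nℚ≢0 {suc n} _ eq with () ← nℚ-injective {suc n} {0} eq

nℚ[1+n]≢0 : ∀ n → nℚ (suc n) ≢ 0ℚ
nℚ[1+n]≢0 n = nℚ≢0 {suc n} (s≤s z≤n)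

module _ where
  open +-*-Solver
  open ≡.≡-Reasoning

  inv-inverseʳ : ∀ {q} → q ≢ 0ℚ → q * inv q ≡ 1ℚ
  inv-inverseʳ {q} q≢0 with q ℚ.≟ 0ℚ
  ... | yes q≡0 = ⊥-elim (q≢0 q≡0)
  ... | no q≢0′ = ≡.trans (≡.cong (q *_) (ℚ.*-identityˡ _)) (ℚ.*-inverseʳ q {{ℚ.≢-nonZero q≢0′}})

  inv-inverseˡ : ∀ {q} → q ≢ 0ℚ → inv q * q ≡ 1ℚ
  inv-inverseˡ {q} q≢0 = ≡.trans (ℚ.*-comm (inv q) q) (inv-inverseʳ q≢0)

  *-cancelʳ : ∀ {x y c} → c ≢ 0ℚ → x * c ≡ y * c → x ≡ y
  *-cancelʳ {x} {y} {c} c≢0 eq = begin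
    x                  ≡⟨ solve 2 (λ x i → x := x :* con 1ℚ) ≡.refl x (inv c) ⟩
    x * 1ℚ             ≡⟨ ≡.cong (x *_) (inv-inverseʳ c≢0) ⟨
    x * (c * inv c)    ≡⟨ ℚ.*-assoc x c (inv c) ⟨
    x * c * inv c      ≡⟨ ≡.cong (_* inv c) eq ⟩
    y * c * inv c      ≡⟨ ℚ.*-assoc y c (inv c) ⟩
    y * (c * inv c)    ≡⟨ ≡.cong (y *_) (inv-inverseʳ c≢0) ⟩
    y * 1ℚ             ≡⟨ ℚ.*-identityʳ y ⟩
    y                  ∎

  *≡0⇒≡0 : ∀ {x c} → c ≢ 0ℚ → x * c ≡ 0ℚ → x ≡ 0ℚ
  *≡0⇒≡0 {x} {c} c≢0 eq = *-cancelʳ c≢0 (≡.trans eq (≡.sym (ℚ.*-zeroˡ c)))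

  *-≢0 : ∀ {x y} → x ≢ 0ℚ → y ≢ 0ℚ → x * y ≢ 0ℚ
  *-≢0 x≢0 y≢0 eq = x≢0 (*≡0⇒≡0 y≢0 eq)

  inv-≢0 : ∀ {x} → x ≢ 0ℚ → inv x ≢ 0ℚ
  inv-≢0 {x} x≢0 eq = ℚ.1≢0 (begin
    1ℚ          ≡⟨ inv-inverseˡ x≢0 ⟨
    inv x * x   ≡⟨ ≡.cong (_* x) eq ⟩
    0ℚ * x      ≡⟨ ℚ.*-zeroˡ x ⟩
    0ℚ          ∎)

  cross-multiply : ∀ a b c d → b ≢ 0ℚ → d ≢ 0ℚ → a * d ≡ c * b → a * inv b ≡ c * inv d
  cross-multiply a b c d b≢0 d≢0 eq = *-cancelʳ (*-≢0 b≢0 d≢0) (begin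
    a * inv b * (b * d)      ≡⟨ solve 4 (λ a i b d → a :* i :* (b :* d) := i :* b :* (a :* d)) ≡.refl a (inv b) b d ⟩
    inv b * b * (a * d)      ≡⟨ ≡.cong₂ _*_ (inv-inverseˡ b≢0) eq ⟩
    1ℚ * (c * b)             ≡⟨ ≡.cong (λ z → z * (c * b)) (inv-inverseˡ d≢0) ⟨
    inv d * d * (c * b)      ≡⟨ solve 4 (λ c b i d → i :* d :* (c :* b) := c :* i :* (b :* d)) ≡.refl c b (inv d) d ⟩
    c * inv d * (b * d)      ∎)

  inv-distrib-* : ∀ {x y} → x ≢ 0ℚ → y ≢ 0ℚ → inv (x * y) ≡ inv x * inv y
  inv-distrib-* {x} {y} x≢0 y≢0 = *-cancelʳ (*-≢0 x≢0 y≢0) (begin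
    inv (x * y) * (x * y)    ≡⟨ inv-inverseˡ (*-≢0 x≢0 y≢0) ⟩
    1ℚ                       ≡⟨ ≡.cong₂ _*_ (inv-inverseˡ x≢0) (inv-inverseˡ y≢0) ⟨
    inv x * x * (inv y * y)  ≡⟨ solve 4 (λ a x b y → a :* x :* (b :* y) := a :* b :* (x :* y)) ≡.refl (inv x) x (inv y) y ⟩
    inv x * inv y * (x * y)  ∎)

  ^-≢0 : ∀ {x} → x ≢ 0ℚ → ∀ k → x ^ k ≢ 0ℚ
  ^-≢0 x≢0 zero ()
  ^-≢0 x≢0 (suc k) = *-≢0 x≢0 (^-≢0 x≢0 k)

  inv-^ : ∀ {x} → x ≢ 0ℚ → ∀ k → inv (x ^ k) ≡ inv x ^ k
  inv-^ x≢0 zero = ≡.refl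
  inv-^ {x} x≢0 (suc k) = ≡.trans (inv-distrib-* x≢0 (^-≢0 x≢0 k)) (≡.cong (inv x *_) (inv-^ x≢0 k))


C*[k!*[n∸k]!]≡n! : ∀ {n k} → k ≤ n → (n C k) ℕ.* (k ! ℕ.* (n ∸ k) !) ≡ n !
C*[k!*[n∸k]!]≡n! {n} {k} k≤n = ≡.trans (≡.cong (ℕ._* (k ! ℕ.* (n ∸ k) !)) (nCk≡n!/k![n-k]! k≤n))
  (m/n*n≡m {{k ℕ.!* (n ∸ k) !≢0}} (k![n∸k]!∣n! k≤n))

C-absorb : ∀ {n k} → k ≤ n → suc k ℕ.* (suc n C suc k) ≡ suc n ℕ.* (n C k)
C-absorb {n} {k} k≤n = ℕ.*-cancelʳ-≡ _ _ (k ! ℕ.* (n ∸ k) !) {{k ℕ.!* (n ∸ k) !≢0}} (begin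
  suc k ℕ.* (suc n C suc k) ℕ.* (k ! ℕ.* (n ∸ k) !)   ≡⟨ rearrange (suc k) (suc n C suc k) (k !) ((n ∸ k) !) ⟩
  (suc n C suc k) ℕ.* (suc k ! ℕ.* (n ∸ k) !)         ≡⟨ C*[k!*[n∸k]!]≡n! (s≤s k≤n) ⟩
  suc n !                                               ≡⟨ ≡.cong (suc n ℕ.*_) (C*[k!*[n∸k]!]≡n! k≤n) ⟨
  suc n ℕ.* ((n C k) ℕ.* (k ! ℕ.* (n ∸ k) !))         ≡⟨ ℕ.*-assoc (suc n) (n C k) _ ⟨
  suc n ℕ.* (n C k) ℕ.* (k ! ℕ.* (n ∸ k) !)           ∎)
  where
  open ≡.≡-Reasoning
  rearrange : ∀ a c f g → a ℕ.* c ℕ.* (f ℕ.* g) ≡ c ℕ.* (a ℕ.* f ℕ.* g)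
  rearrange = solve-∀

invFact : ℕ → ℚ
invFact m = inv (nℚ (m !))

nℚ[n!]≢0 : ∀ n → nℚ (n !) ≢ 0ℚ
nℚ[n!]≢0 n = nℚ≢0 (ℕ.n≢0⇒n>0 (ℕ.≢-nonZero⁻¹ (n !) {{n ℕ.!≢0}}))

invFact≢0 : ∀ n → invFact n ≢ 0ℚ
invFact≢0 n = inv-≢0 (nℚ[n!]≢0 n)

invFact*≡0 : ∀ m {x} → invFact m * x ≡ 0ℚ → x ≡ 0ℚ
invFact*≡0 m {x} eq = *≡0⇒≡0 (invFact≢0 m) (≡.trans (ℚ.*-comm x (invFact m)) eq)

C*invFact : ∀ {m k} → k ≤ m → nℚ (m C k) * invFact m ≡ invFact k * invFact (m ∸ k)
C*invFact {m} {k} k≤m = *-cancelʳ (*-≢0 (nℚ[n!]≢0 k) (nℚ[n!]≢0 (m ∸ k))) (begin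
  nℚ (m C k) * invFact m * (nℚ (k !) * nℚ ((m ∸ k) !))
    ≡⟨ solve 3 (λ c f d → c :* f :* d := f :* (c :* d)) ≡.refl (nℚ (m C k)) (invFact m) _ ⟩
  invFact m * (nℚ (m C k) * (nℚ (k !) * nℚ ((m ∸ k) !)))    ≡⟨ ≡.cong (λ z → invFact m * (nℚ (m C k) * z)) (nℚ-* (k !) ((m ∸ k) !)) ⟨
  invFact m * (nℚ (m C k) * nℚ (k ! ℕ.* (m ∸ k) !))         ≡⟨ ≡.cong (invFact m *_) (nℚ-* (m C k) _) ⟨
  invFact m * nℚ ((m C k) ℕ.* (k ! ℕ.* (m ∸ k) !))          ≡⟨ ≡.cong (λ z → invFact m * nℚ z) (C*[k!*[n∸k]!]≡n! k≤m) ⟩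
  invFact m * nℚ (m !)                                       ≡⟨ inv-inverseˡ (nℚ[n!]≢0 m) ⟩
  1ℚ                                                         ≡⟨ ≡.cong₂ _*_ (inv-inverseˡ (nℚ[n!]≢0 k)) (inv-inverseˡ (nℚ[n!]≢0 (m ∸ k))) ⟨
  invFact k * nℚ (k !) * (invFact (m ∸ k) * nℚ ((m ∸ k) !))
    ≡⟨ solve 4 (λ a x b y → a :* x :* (b :* y) := a :* b :* (x :* y)) ≡.refl (invFact k) _ (invFact (m ∸ k)) _ ⟩
  invFact k * invFact (m ∸ k) * (nℚ (k !) * nℚ ((m ∸ k) !))  ∎)
  where
  open ≡.≡-Reasoning
  open +-*-Solver

C-absorb-complement : ∀ {n k} → k ≤ n → (n ∸ k ℕ.+ 1) ℕ.* (suc n C k) ≡ suc n ℕ.* (n C k)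
C-absorb-complement {n} {k} k≤n = begin
  (n ∸ k ℕ.+ 1) ℕ.* (suc n C k)              ≡⟨ ≡.cong₂ ℕ._*_ (ℕ.+-comm (n ∸ k) 1) (nCk≡nC[n∸k] (ℕ.m≤n⇒m≤1+n k≤n)) ⟩
  suc (n ∸ k) ℕ.* (suc n C (suc n ∸ k))      ≡⟨ ≡.cong (λ i → suc (n ∸ k) ℕ.* (suc n C i)) (ℕ.+-∸-assoc 1 k≤n) ⟩
  suc (n ∸ k) ℕ.* (suc n C suc (n ∸ k))      ≡⟨ C-absorb (ℕ.m∸n≤m n k) ⟩
  suc n ℕ.* (n C (n ∸ k))                    ≡⟨ ≡.cong (suc n ℕ.*_) (nCk≡nC[n∸k] k≤n) ⟨
  suc n ℕ.* (n C k)                          ∎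
  where open ≡.≡-Reasoning

C/[1+k] : ∀ {n k} → k ≤ n → nℚ (n C k) * inv (nℚ (suc k)) ≡ nℚ (suc n C suc k) * inv (nℚ (suc n))
C/[1+k] {n} {k} k≤n =
  cross-multiply (nℚ (n C k)) (nℚ (suc k)) (nℚ (suc n C suc k)) (nℚ (suc n)) (nℚ[1+n]≢0 k) (nℚ[1+n]≢0 n) (begin
  nℚ (n C k) * nℚ (suc n)                ≡⟨ nℚ-* (n C k) (suc n) ⟨
  nℚ ((n C k) ℕ.* suc n)                 ≡⟨ ≡.cong nℚ (≡.trans (ℕ.*-comm (n C k) (suc n)) (≡.sym (C-absorb k≤n))) ⟩
  nℚ (suc k ℕ.* (suc n C suc k))         ≡⟨ ≡.trans (nℚ-* (suc k) (suc n C suc k)) (ℚ.*-comm (nℚ (suc k)) (nℚ (suc n C suc k))) ⟩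
  nℚ (suc n C suc k) * nℚ (suc k)        ∎)
  where open ≡.≡-Reasoning

C/[n∸k+1] : ∀ {n k} → k ≤ n → nℚ (n C k) * inv (nℚ (n ∸ k ℕ.+ 1)) ≡ nℚ (suc n C k) * inv (nℚ (suc n))
C/[n∸k+1] {n} {k} k≤n =
  cross-multiply (nℚ (n C k)) (nℚ (n ∸ k ℕ.+ 1)) (nℚ (suc n C k)) (nℚ (suc n)) n∸k+1≢0 (nℚ[1+n]≢0 n) (begin
  nℚ (n C k) * nℚ (suc n)                ≡⟨ nℚ-* (n C k) (suc n) ⟨
  nℚ ((n C k) ℕ.* suc n)                 ≡⟨ ≡.cong nℚ (≡.trans (ℕ.*-comm (n C k) (suc n)) (≡.sym (C-absorb-complement k≤n))) ⟩
  nℚ ((n ∸ k ℕ.+ 1) ℕ.* (suc n C k))     ≡⟨ ≡.trans (nℚ-* (n ∸ k ℕ.+ 1) (suc n C k)) (ℚ.*-comm (nℚ (n ∸ k ℕ.+ 1)) (nℚ (suc n C k))) ⟩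
  nℚ (suc n C k) * nℚ (n ∸ k ℕ.+ 1)      ∎)
  where
  open ≡.≡-Reasoning
  n∸k+1≢0 : nℚ (n ∸ k ℕ.+ 1) ≢ 0ℚ
  n∸k+1≢0 = nℚ≢0 {n ∸ k ℕ.+ 1} (ℕ.m≤n+m 1 (n ∸ k))

C/[1+k][2+k] : ∀ {n k} → k ≤ n →
  nℚ (n C k) * (inv (nℚ (suc k)) * inv (nℚ (suc (suc k))))
    ≡ nℚ (suc (suc n) C suc (suc k)) * (inv (nℚ (suc n)) * inv (nℚ (suc (suc n))))
C/[1+k][2+k] {n} {k} k≤n = begin
  nℚ (n C k) * (inv (nℚ (suc k)) * inv (nℚ (suc (suc k))))
    ≡⟨ ℚ.*-assoc (nℚ (n C k)) _ _ ⟨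
  nℚ (n C k) * inv (nℚ (suc k)) * inv (nℚ (suc (suc k)))
    ≡⟨ ≡.cong (_* inv (nℚ (suc (suc k)))) (C/[1+k] k≤n) ⟩
  nℚ (suc n C suc k) * inv (nℚ (suc n)) * inv (nℚ (suc (suc k)))
    ≡⟨ solve 3 (λ c i j → c :* i :* j := c :* j :* i) ≡.refl (nℚ (suc n C suc k)) (inv (nℚ (suc n))) (inv (nℚ (suc (suc k)))) ⟩
  nℚ (suc n C suc k) * inv (nℚ (suc (suc k))) * inv (nℚ (suc n))
    ≡⟨ ≡.cong (_* inv (nℚ (suc n))) (C/[1+k] (s≤s k≤n)) ⟩
  nℚ (suc (suc n) C suc (suc k)) * inv (nℚ (suc (suc n))) * inv (nℚ (suc n))
    ≡⟨ solve 3 (λ c i j → c :* i :* j := c :* (j :* i)) ≡.refl (nℚ (suc (suc n) C suc (suc k))) (inv (nℚ (suc (suc n)))) (inv (nℚ (suc n))) ⟩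
  nℚ (suc (suc n) C suc (suc k)) * (inv (nℚ (suc n)) * inv (nℚ (suc (suc n)))) ∎
  where
  open ≡.≡-Reasoning
  open +-*-Solver

Σ-C/[1+k] : ∀ N (a : ℕ → ℚ) → a 0 ≡ 0ℚ →
  Σ< (suc N) (λ k → nℚ (N C k) * inv (nℚ (suc k)) * a (suc k)) ≡ inv (nℚ (suc N)) * Σ< (suc (suc N)) (λ i → nℚ (suc N C i) * a i)
Σ-C/[1+k] N a a0≡0 = begin
  Σ< (suc N) (λ k → nℚ (N C k) * inv (nℚ (suc k)) * a (suc k))
    ≡⟨ Σ-cong (suc N) (λ k k<1+N → absorb k (ℕ.≤-pred k<1+N)) ⟩
  Σ< (suc N) (λ k → inv (nℚ (suc N)) * g (suc k))
    ≡⟨ *-distribˡ-Σ (suc N) (inv (nℚ (suc N))) (λ k → g (suc k)) ⟨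
  inv (nℚ (suc N)) * Σ< (suc N) (λ k → g (suc k))
    ≡⟨ ≡.cong (inv (nℚ (suc N)) *_) (≡.trans (≡.cong (_+ Σ< (suc N) (λ k → g (suc k))) g0≡0) (ℚ.+-identityˡ _)) ⟨
  inv (nℚ (suc N)) * (g 0 + Σ< (suc N) (λ k → g (suc k)))
    ≡⟨ ≡.cong (inv (nℚ (suc N)) *_) (Σ-head (suc N) g) ⟨
  inv (nℚ (suc N)) * Σ< (suc (suc N)) g ∎
  where
  open ≡.≡-Reasoning
  g : ℕ → ℚ
  g i = nℚ (suc N C i) * a i
  g0≡0 : g 0 ≡ 0ℚ
  g0≡0 = ≡.trans (≡.cong (nℚ (suc N C 0) *_) a0≡0) (ℚ.*-zeroʳ (nℚ (suc N C 0)))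
  absorb : ∀ k → k ≤ N → nℚ (N C k) * inv (nℚ (suc k)) * a (suc k) ≡ inv (nℚ (suc N)) * g (suc k)
  absorb k k≤N = ≡.trans (≡.cong (_* a (suc k)) (C/[1+k] k≤N))
    (solve 3 (λ c i x → c :* i :* x := i :* (c :* x)) ≡.refl (nℚ (suc N C suc k)) (inv (nℚ (suc N))) (a (suc k)))
    where open +-*-Solver

2^k[2^[k+3]-2]≡[4^[2+k]-2^[2+k]]/2 : ∀ k →
  nℚ (2 ℕ.^ k) * (nℚ (2 ℕ.^ (k ℕ.+ 3)) - nℚ 2) ≡ (nℚ 4 ^ suc (suc k) - nℚ 2 ^ suc (suc k)) * inv (nℚ 2)
2^k[2^[k+3]-2]≡[4^[2+k]-2^[2+k]]/2 k = begin
  nℚ (2 ℕ.^ k) * (nℚ (2 ℕ.^ (k ℕ.+ 3)) - nℚ 2)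
    ≡⟨ ≡.cong₂ (λ x y → x * (y - nℚ 2)) (nℚ-^ 2 k) (≡.trans (nℚ-^ 2 (k ℕ.+ 3)) (^-homo-* (nℚ 2) k 3)) ⟩
  x * (x * nℚ 2 ^ 3 - nℚ 2)
    ≡⟨ solve 1 (λ x → x :* (x :* con (nℚ 2 ^ 3) :- con (nℚ 2))
                   := (con (nℚ 4) :* x :* (con (nℚ 4) :* x) :- con (nℚ 4) :* x) :* con (inv (nℚ 2))) ≡.refl x ⟩
  (nℚ 4 * x * (nℚ 4 * x) - nℚ 4 * x) * inv (nℚ 2)
    ≡⟨ ≡.cong (λ y → (y * y - y) * inv (nℚ 2)) (^-homo-* (nℚ 2) 2 k) ⟨
  (nℚ 2 ^ suc (suc k) * nℚ 2 ^ suc (suc k) - nℚ 2 ^ suc (suc k)) * inv (nℚ 2)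
    ≡⟨ ≡.cong (λ y → (y - nℚ 2 ^ suc (suc k)) * inv (nℚ 2)) (^-distrib-* (nℚ 2) (nℚ 2) (suc (suc k))) ⟨
  (nℚ 4 ^ suc (suc k) - nℚ 2 ^ suc (suc k)) * inv (nℚ 2) ∎
  where
  open ≡.≡-Reasoning
  open +-*-Solver
  x : ℚ
  x = nℚ 2 ^ k

parity : ∀ n → (Σ ℕ λ p → n ≡ p ℕ.+ p) ⊎ (Σ ℕ λ p → n ≡ suc (p ℕ.+ p))
parity zero = inj₁ (0 , ≡.refl)
parity (suc n) with parity n
... | inj₁ (p , n≡p+p) = inj₂ (p , ≡.cong suc n≡p+p)
... | inj₂ (p , n≡1+p+p) = inj₁ (suc p , ≡.cong suc (≡.trans n≡1+p+p (≡.sym (ℕ.+-suc p p))))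

-1^[p+p]≡1 : ∀ p → (- 1ℚ) ^ (p ℕ.+ p) ≡ 1ℚ
-1^[p+p]≡1 zero = ≡.refl
-1^[p+p]≡1 (suc p) = ≡.trans (≡.cong (λ i → (- 1ℚ) ^ suc i) (ℕ.+-suc p p))
  (≡.cong (λ x → - 1ℚ * (- 1ℚ * x)) (-1^[p+p]≡1 p))

-1^[1+p+p]≡-1 : ∀ p → (- 1ℚ) ^ suc (p ℕ.+ p) ≡ - 1ℚ
-1^[1+p+p]≡-1 p = ≡.cong (- 1ℚ *_) (-1^[p+p]≡1 p)

x+x≡0⇒x≡0 : ∀ {x} → x + x ≡ 0ℚ → x ≡ 0ℚ
x+x≡0⇒x≡0 {x} eq = *≡0⇒≡0 {c = nℚ 2} (λ ()) (≡.trans (solve 1 (λ x → x :* con (nℚ 2) := x :+ x) ≡.refl x) eq)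
  where open +-*-Solver

1+sgn*-cong-even : ∀ n → 1 ≤ n → ∀ x y → (∀ p → n ≡ suc (suc (p ℕ.+ p)) → x ≡ y) →
  (1ℚ + sgn n) * x ≡ (1ℚ + sgn n) * y
1+sgn*-cong-even n 1≤n x y even⇒x≡y with parity n
... | inj₁ (zero , ≡.refl) = ⊥-elim (ℕ.<⇒≱ 1≤n z≤n)
... | inj₁ (suc p , ≡.refl) = ≡.cong ((1ℚ + sgn n) *_) (even⇒x≡y p (≡.cong suc (ℕ.+-suc p p)))
... | inj₂ (p , ≡.refl) = ≡.trans (≡.cong (_* x) 1+sgn≡0) (≡.trans (ℚ.*-zeroˡ x)
        (≡.sym (≡.trans (≡.cong (_* y) 1+sgn≡0) (ℚ.*-zeroˡ y))))
  where
  1+sgn≡0 : 1ℚ + sgn n ≡ 0ℚ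
  1+sgn≡0 = ≡.cong (1ℚ +_) (≡.trans (^ℚ≡^ (- 1ℚ) n) (-1^[1+p+p]≡-1 p))

-- Formal power series over ℚ

Series : Set
Series = ℕ → ℚ

infixl 6 _⊞_ _⊟_
infixl 7 _⊛_ _·_

_⊞_ _⊟_ _⊛_ : Series → Series → Series
(a ⊞ b) m = a m + b m
(a ⊟ b) m = a m - b m
(a ⊛ b) m = Σ< (suc m) (λ k → a k * b (m ∸ k))

_·_ : ℚ → Series → Series
(c · a) m = c * a m

𝟘 : Series
𝟘 _ = 0ℚ

egf : (ℕ → ℚ) → Series
egf A k = A k * invFact k

expₛ : ℚ → Series
expₛ t = egf (t ^_)

zₛ : Series
zₛ 1 = 1ℚ
zₛ _ = 0ℚ

dilate : ℚ → Series → Series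
dilate t a m = t ^ m * a m

module ≗-Reasoning = Relation.Binary.Reasoning.Setoid (ℕ ≡.→-setoid ℚ)
module ≗ = Setoid (ℕ ≡.→-setoid ℚ)

module SeriesAlgebra where
  open +-*-Solver
  open ≡.≡-Reasoning

  ⊞-cong : ∀ {a a′ b b′} → a ≗ a′ → b ≗ b′ → a ⊞ b ≗ a′ ⊞ b′
  ⊞-cong ea eb m = ≡.cong₂ _+_ (ea m) (eb m)

  ⊟-cong : ∀ {a a′ b b′} → a ≗ a′ → b ≗ b′ → a ⊟ b ≗ a′ ⊟ b′
  ⊟-cong ea eb m = ≡.cong₂ _-_ (ea m) (eb m)

  ⊞-congˡ : ∀ a {b b′} → b ≗ b′ → a ⊞ b ≗ a ⊞ b′
  ⊞-congˡ a = ⊞-cong {a} (λ _ → ≡.refl)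

  ⊞-congʳ : ∀ b {a a′} → a ≗ a′ → a ⊞ b ≗ a′ ⊞ b
  ⊞-congʳ b ea = ⊞-cong {b = b} ea (λ _ → ≡.refl)

  dilate-cong : ∀ t {a a′} → a ≗ a′ → dilate t a ≗ dilate t a′
  dilate-cong t ea m = ≡.cong (t ^ m *_) (ea m)

  ⊛-cong : ∀ {a a′ b b′} → a ≗ a′ → b ≗ b′ → a ⊛ b ≗ a′ ⊛ b′
  ⊛-cong ea eb m = Σ-cong′ (suc m) (λ k → ≡.cong₂ _*_ (ea k) (eb (m ∸ k)))

  ⊛-congˡ : ∀ a {b b′} → b ≗ b′ → a ⊛ b ≗ a ⊛ b′
  ⊛-congˡ a = ⊛-cong {a} (λ _ → ≡.refl)

  ⊛-congʳ : ∀ b {a a′} → a ≗ a′ → a ⊛ b ≗ a′ ⊛ b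
  ⊛-congʳ b ea = ⊛-cong {b = b} ea (λ _ → ≡.refl)

  ⊛-distribˡ-⊞ : ∀ a b c → a ⊛ (b ⊞ c) ≗ a ⊛ b ⊞ a ⊛ c
  ⊛-distribˡ-⊞ a b c m = ≡.trans (Σ-cong′ (suc m) (λ k → ℚ.*-distribˡ-+ (a k) (b (m ∸ k)) (c (m ∸ k))))
    (Σ-distrib-+ (suc m) (λ k → a k * b (m ∸ k)) (λ k → a k * c (m ∸ k)))

  ⊛-distribʳ-⊞ : ∀ a b c → (a ⊞ b) ⊛ c ≗ a ⊛ c ⊞ b ⊛ c
  ⊛-distribʳ-⊞ a b c m = ≡.trans (Σ-cong′ (suc m) (λ k → ℚ.*-distribʳ-+ (c (m ∸ k)) (a k) (b k)))
    (Σ-distrib-+ (suc m) (λ k → a k * c (m ∸ k)) (λ k → b k * c (m ∸ k)))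

  ⊛-distribʳ-⊟ : ∀ a b c → (a ⊟ b) ⊛ c ≗ a ⊛ c ⊟ b ⊛ c
  ⊛-distribʳ-⊟ a b c m = ≡.trans
    (Σ-cong′ (suc m) (λ k → solve 3 (λ x y z → (x :- y) :* z := x :* z :- y :* z) ≡.refl (a k) (b k) (c (m ∸ k))))
    (Σ-distrib-- (suc m) (λ k → a k * c (m ∸ k)) (λ k → b k * c (m ∸ k)))

  ·-⊛ : ∀ c a b → (c · a) ⊛ b ≗ c · (a ⊛ b)
  ·-⊛ c a b m = ≡.trans (Σ-cong′ (suc m) (λ k → ℚ.*-assoc c (a k) (b (m ∸ k))))
    (≡.sym (*-distribˡ-Σ (suc m) c (λ k → a k * b (m ∸ k))))

  Σ-triangle : ∀ m (h : ℕ → ℕ → ℚ) →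
    Σ< (suc m) (λ i → Σ< (suc i) (h i)) ≡ Σ< (suc m) (λ k → Σ< (suc (m ∸ k)) (λ j → h (k ℕ.+ j) k))
  Σ-triangle zero h = ≡.refl
  Σ-triangle (suc m) h = begin
    Σ< (suc m) (λ i → Σ< (suc i) (h i)) + (Σ< (suc m) (h (suc m)) + h (suc m) (suc m))
      ≡⟨ ≡.cong (_+ (Σ< (suc m) (h (suc m)) + h (suc m) (suc m))) (Σ-triangle m h) ⟩
    T m + (Σ< (suc m) (h (suc m)) + h (suc m) (suc m))
      ≡⟨ ℚ.+-assoc (T m) _ _ ⟨
    T m + Σ< (suc m) (h (suc m)) + h (suc m) (suc m)
      ≡⟨ ≡.cong (_+ h (suc m) (suc m)) (Σ-distrib-+ (suc m) (λ k → Σ< (suc (m ∸ k)) (λ j → h (k ℕ.+ j) k)) (h (suc m))) ⟨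
    Σ< (suc m) (λ k → Σ< (suc (m ∸ k)) (λ j → h (k ℕ.+ j) k) + h (suc m) k) + h (suc m) (suc m)
      ≡⟨ ≡.cong₂ _+_ (Σ-cong (suc m) (λ k k<1+m → extend k (ℕ.≤-pred k<1+m)))
                     (≡.trans (≡.sym (ℚ.+-identityˡ _)) (≡.cong (λ i → 0ℚ + h i (suc m)) (≡.sym (ℕ.+-identityʳ (suc m))))) ⟩
    T (suc m) + (0ℚ + h (suc m ℕ.+ 0) (suc m))
      ≡⟨ ≡.cong (λ i → T (suc m) + Σ< (suc i) (λ j → h (suc m ℕ.+ j) (suc m))) (ℕ.n∸n≡0 m) ⟨
    Σ< (suc (suc m)) (λ k → Σ< (suc (suc m ∸ k)) (λ j → h (k ℕ.+ j) k)) ∎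
    where
    T : ℕ → ℚ
    T n = Σ< (suc m) (λ k → Σ< (suc (n ∸ k)) (λ j → h (k ℕ.+ j) k))
    extend : ∀ k → k ≤ m → Σ< (suc (m ∸ k)) (λ j → h (k ℕ.+ j) k) + h (suc m) k
                          ≡ Σ< (suc (suc m ∸ k)) (λ j → h (k ℕ.+ j) k)
    extend k k≤m = begin
      Σ< (suc (m ∸ k)) (λ j → h (k ℕ.+ j) k) + h (suc m) k
        ≡⟨ ≡.cong (λ i → Σ< (suc (m ∸ k)) (λ j → h (k ℕ.+ j) k) + h i k)
             (≡.trans (≡.cong suc (≡.sym (ℕ.m+[n∸m]≡n k≤m))) (≡.sym (ℕ.+-suc k (m ∸ k)))) ⟩
      Σ< (suc (suc (m ∸ k))) (λ j → h (k ℕ.+ j) k)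
        ≡⟨ ≡.cong (λ i → Σ< (suc i) (λ j → h (k ℕ.+ j) k)) (ℕ.+-∸-assoc 1 k≤m) ⟨
      Σ< (suc (suc m ∸ k)) (λ j → h (k ℕ.+ j) k) ∎

  ⊛-assoc : ∀ a b c → (a ⊛ b) ⊛ c ≗ a ⊛ (b ⊛ c)
  ⊛-assoc a b c m = begin
    Σ< (suc m) (λ i → Σ< (suc i) (λ k → a k * b (i ∸ k)) * c (m ∸ i))
      ≡⟨ Σ-cong′ (suc m) (λ i → *-distribʳ-Σ (suc i) (c (m ∸ i)) (λ k → a k * b (i ∸ k))) ⟩
    Σ< (suc m) (λ i → Σ< (suc i) (λ k → a k * b (i ∸ k) * c (m ∸ i)))
      ≡⟨ Σ-triangle m (λ i k → a k * b (i ∸ k) * c (m ∸ i)) ⟩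
    Σ< (suc m) (λ k → Σ< (suc (m ∸ k)) (λ j → a k * b (k ℕ.+ j ∸ k) * c (m ∸ (k ℕ.+ j))))
      ≡⟨ Σ-cong′ (suc m) (λ k → Σ-cong′ (suc (m ∸ k)) (reindex k)) ⟩
    Σ< (suc m) (λ k → Σ< (suc (m ∸ k)) (λ j → a k * (b j * c (m ∸ k ∸ j))))
      ≡⟨ Σ-cong′ (suc m) (λ k → *-distribˡ-Σ (suc (m ∸ k)) (a k) (λ j → b j * c (m ∸ k ∸ j))) ⟨
    (a ⊛ (b ⊛ c)) m ∎
    where
    reindex : ∀ k j → a k * b (k ℕ.+ j ∸ k) * c (m ∸ (k ℕ.+ j)) ≡ a k * (b j * c (m ∸ k ∸ j))
    reindex k j = ≡.trans (≡.cong₂ (λ x y → a k * b x * c y) (ℕ.m+n∸m≡n k j) (≡.sym (ℕ.∸-+-assoc m k j)))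
      (ℚ.*-assoc (a k) (b j) (c (m ∸ k ∸ j)))

  even⇒odd-coefficients-vanish : ∀ {a} → dilate (- 1ℚ) a ≗ a → ∀ p → a (suc (p ℕ.+ p)) ≡ 0ℚ
  even⇒odd-coefficients-vanish {a} a-even p = x+x≡0⇒x≡0 (begin
    a M + a M                        ≡⟨ ≡.cong (_+ a M) (a-even M) ⟨
    (- 1ℚ) ^ M * a M + a M           ≡⟨ ≡.cong (λ s → s * a M + a M) (-1^[1+p+p]≡-1 p) ⟩
    - 1ℚ * a M + a M                 ≡⟨ solve 1 (λ x → con (- 1ℚ) :* x :+ x := con 0ℚ) ≡.refl (a M) ⟩
    0ℚ                               ∎)
    where
    M : ℕ
    M = suc (p ℕ.+ p)

  odd⇒even-coefficients-vanish : ∀ {a} → a ⊞ dilate (- 1ℚ) a ≗ 𝟘 → ∀ p → a (p ℕ.+ p) ≡ 0ℚ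
  odd⇒even-coefficients-vanish {a} a-odd p = x+x≡0⇒x≡0 (begin
    a M + a M                        ≡⟨ ≡.cong (λ x → a M + x) (ℚ.*-identityˡ (a M)) ⟨
    a M + 1ℚ * a M                   ≡⟨ ≡.cong (λ s → a M + s * a M) (-1^[p+p]≡1 p) ⟨
    a M + (- 1ℚ) ^ M * a M           ≡⟨ a-odd M ⟩
    0ℚ                               ∎)
    where
    M : ℕ
    M = p ℕ.+ p

  egf-⊛ : ∀ A B m → (egf A ⊛ egf B) m ≡ invFact m * Σ< (suc m) (λ k → nℚ (m C k) * (A k * B (m ∸ k)))
  egf-⊛ A B m = ≡.trans (Σ-cong (suc m) (λ k k<1+m → term k (ℕ.≤-pred k<1+m)))
    (≡.sym (*-distribˡ-Σ (suc m) (invFact m) (λ k → nℚ (m C k) * (A k * B (m ∸ k)))))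
    where
    term : ∀ k → k ≤ m → A k * invFact k * (B (m ∸ k) * invFact (m ∸ k))
                        ≡ invFact m * (nℚ (m C k) * (A k * B (m ∸ k)))
    term k k≤m = begin
      A k * invFact k * (B (m ∸ k) * invFact (m ∸ k))
        ≡⟨ solve 4 (λ a i b j → a :* i :* (b :* j) := i :* j :* (a :* b)) ≡.refl (A k) (invFact k) (B (m ∸ k)) (invFact (m ∸ k)) ⟩
      invFact k * invFact (m ∸ k) * (A k * B (m ∸ k))
        ≡⟨ ≡.cong (_* (A k * B (m ∸ k))) (C*invFact k≤m) ⟨
      nℚ (m C k) * invFact m * (A k * B (m ∸ k))
        ≡⟨ solve 3 (λ c i x → c :* i :* x := i :* (c :* x)) ≡.refl (nℚ (m C k)) (invFact m) (A k * B (m ∸ k)) ⟩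
      invFact m * (nℚ (m C k) * (A k * B (m ∸ k))) ∎

  expₛ-⊛ : ∀ s t → expₛ s ⊛ expₛ t ≗ expₛ (s + t)
  expₛ-⊛ s t m = begin
    (expₛ s ⊛ expₛ t) m
      ≡⟨ egf-⊛ (s ^_) (t ^_) m ⟩
    invFact m * Σ< (suc m) (λ k → nℚ (m C k) * (s ^ k * t ^ (m ∸ k)))
      ≡⟨ ≡.cong (invFact m *_) (Σ-cong′ (suc m) (λ k → ×ℚ≡nℚ* (m C k) _)) ⟨
    invFact m * Σ< (suc m) (λ k → (m C k) ×ℚ (s ^ k * t ^ (m ∸ k)))
      ≡⟨ ≡.cong (invFact m *_) (binomial-theorem m s t) ⟩
    invFact m * (s + t) ^ m
      ≡⟨ ℚ.*-comm (invFact m) _ ⟩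
    expₛ (s + t) m ∎

  ⊛-expₛ0 : ∀ a → a ⊛ expₛ 0ℚ ≗ a
  ⊛-expₛ0 a m = begin
    Σ< m (λ k → a k * expₛ 0ℚ (m ∸ k)) + a m * expₛ 0ℚ (m ∸ m)
      ≡⟨ ≡.cong₂ _+_ (Σ-zero m (λ k k<m → vanish k k<m)) (≡.cong (λ i → a m * expₛ 0ℚ i) (ℕ.n∸n≡0 m)) ⟩
    0ℚ + a m * (1ℚ * 1ℚ)
      ≡⟨ solve 1 (λ x → con 0ℚ :+ x :* (con 1ℚ :* con 1ℚ) := x) ≡.refl (a m) ⟩
    a m ∎
    where
    vanish : ∀ k → k < m → a k * expₛ 0ℚ (m ∸ k) ≡ 0ℚ
    vanish k k<m with m ∸ k in eq
    ... | zero = ⊥-elim (ℕ.m<n⇒n≢0 (ℕ.m<n⇒0<n∸m k<m) eq)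
    ... | suc i = solve 3 (λ x p f → x :* (con 0ℚ :* p :* f) := con 0ℚ) ≡.refl (a k) (0ℚ ^ i) (invFact (suc i))

  dilate-⊛ : ∀ t a b → dilate t (a ⊛ b) ≗ dilate t a ⊛ dilate t b
  dilate-⊛ t a b m = ≡.trans (*-distribˡ-Σ (suc m) (t ^ m) (λ k → a k * b (m ∸ k)))
    (Σ-cong (suc m) (λ k k<1+m → split k (ℕ.≤-pred k<1+m)))
    where
    split : ∀ k → k ≤ m → t ^ m * (a k * b (m ∸ k)) ≡ t ^ k * a k * (t ^ (m ∸ k) * b (m ∸ k))
    split k k≤m = begin
      t ^ m * (a k * b (m ∸ k))
        ≡⟨ ≡.cong (λ i → t ^ i * (a k * b (m ∸ k))) (ℕ.m+[n∸m]≡n k≤m) ⟨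
      t ^ (k ℕ.+ (m ∸ k)) * (a k * b (m ∸ k))
        ≡⟨ ≡.cong (_* (a k * b (m ∸ k))) (^-homo-* t k (m ∸ k)) ⟩
      t ^ k * t ^ (m ∸ k) * (a k * b (m ∸ k))
        ≡⟨ solve 4 (λ p q x y → p :* q :* (x :* y) := p :* x :* (q :* y)) ≡.refl (t ^ k) (t ^ (m ∸ k)) (a k) (b (m ∸ k)) ⟩
      t ^ k * a k * (t ^ (m ∸ k) * b (m ∸ k)) ∎

  dilate-dilate : ∀ s t a → dilate s (dilate t a) ≗ dilate (s * t) a
  dilate-dilate s t a m = ≡.trans (≡.sym (ℚ.*-assoc (s ^ m) (t ^ m) (a m))) (≡.cong (_* a m) (≡.sym (^-distrib-* s t m)))

  dilate-expₛ : ∀ t s → dilate t (expₛ s) ≗ expₛ (t * s)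
  dilate-expₛ t s = dilate-dilate t s (λ m → invFact m)

  dilate-⊞ : ∀ t a b → dilate t (a ⊞ b) ≗ dilate t a ⊞ dilate t b
  dilate-⊞ t a b m = ℚ.*-distribˡ-+ (t ^ m) (a m) (b m)

  dilate-· : ∀ t c a → dilate t (c · a) ≗ c · dilate t a
  dilate-· t c a m = solve 3 (λ p c x → p :* (c :* x) := c :* (p :* x)) ≡.refl (t ^ m) c (a m)

  dilate-zₛ : ∀ t → dilate t zₛ ≗ t · zₛ
  dilate-zₛ t 0 = ≡.trans (ℚ.*-zeroʳ 1ℚ) (≡.sym (ℚ.*-zeroʳ t))
  dilate-zₛ t 1 = ≡.cong (_* 1ℚ) (ℚ.*-identityʳ t)
  dilate-zₛ t (suc (suc m)) = ≡.trans (ℚ.*-zeroʳ (t ^ suc (suc m))) (≡.sym (ℚ.*-zeroʳ t))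

  ⊛-cancelʳ-𝟘 : ∀ {a c} → c 0 ≢ 0ℚ → a ⊛ c ≗ 𝟘 → a ≗ 𝟘
  ⊛-cancelʳ-𝟘 {a} {c} c0≢0 a⊛c≗𝟘 = <-rec (λ k → a k ≡ 0ℚ) step
    where
    step : ∀ k → (∀ {i} → i < k → a i ≡ 0ℚ) → a k ≡ 0ℚ
    step k ih = *≡0⇒≡0 c0≢0 (begin
      a k * c 0                               ≡⟨ ≡.cong (λ j → a k * c j) (ℕ.n∸n≡0 k) ⟨
      a k * c (k ∸ k)                         ≡⟨ ℚ.+-identityˡ _ ⟨
      0ℚ + a k * c (k ∸ k)                    ≡⟨ ≡.cong (_+ a k * c (k ∸ k)) (Σ-zero k vanish) ⟨
      (a ⊛ c) k                               ≡⟨ a⊛c≗𝟘 k ⟩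
      0ℚ                                      ∎)
      where
      vanish : ∀ i → i < k → a i * c (k ∸ i) ≡ 0ℚ
      vanish i i<k = ≡.trans (≡.cong (_* c (k ∸ i)) (ih i<k)) (ℚ.*-zeroˡ (c (k ∸ i)))

  -- e^z - 1 is z times a unit, hence not a zero divisor.
  ⊛expₛ1-unique : ∀ {a b c} → a ⊛ expₛ 1ℚ ≗ a ⊞ c → b ⊛ expₛ 1ℚ ≗ b ⊞ c → a ≗ b
  ⊛expₛ1-unique {a} {b} {c} ea eb m = begin
    a m                 ≡⟨ solve 2 (λ x y → x := x :- y :+ y) ≡.refl (a m) (b m) ⟩
    d m + b m           ≡⟨ ≡.cong (_+ b m) (⊛-cancelʳ-𝟘 {d} {λ i → expₛ 1ℚ (suc i)} (λ ()) d⊛shift≗𝟘 m) ⟩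
    0ℚ + b m            ≡⟨ ℚ.+-identityˡ (b m) ⟩
    b m                 ∎
    where
    d : Series
    d = a ⊟ b
    d⊛expₛ1≗d : d ⊛ expₛ 1ℚ ≗ d
    d⊛expₛ1≗d k = begin
      (d ⊛ expₛ 1ℚ) k                    ≡⟨ ⊛-distribʳ-⊟ a b (expₛ 1ℚ) k ⟩
      (a ⊛ expₛ 1ℚ) k - (b ⊛ expₛ 1ℚ) k  ≡⟨ ≡.cong₂ _-_ (ea k) (eb k) ⟩
      (a k + c k) - (b k + c k)          ≡⟨ solve 3 (λ x y z → (x :+ z) :- (y :+ z) := x :- y) ≡.refl (a k) (b k) (c k) ⟩
      d k                                ∎
    d⊛shift≗𝟘 : d ⊛ (λ i → expₛ 1ℚ (suc i)) ≗ 𝟘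
    d⊛shift≗𝟘 k = begin
      Σ< (suc k) (λ i → d i * expₛ 1ℚ (suc (k ∸ i)))
        ≡⟨ Σ-cong (suc k) (λ i i<1+k → ≡.cong (λ j → d i * expₛ 1ℚ j) (≡.sym (ℕ.+-∸-assoc 1 (ℕ.≤-pred i<1+k)))) ⟩
      Σ< (suc k) (λ i → d i * expₛ 1ℚ (suc k ∸ i))
        ≡⟨ solve 2 (λ s x → s := s :+ x :* con 1ℚ :- x) ≡.refl _ (d (suc k)) ⟩
      Σ< (suc k) (λ i → d i * expₛ 1ℚ (suc k ∸ i)) + d (suc k) * 1ℚ - d (suc k)
        ≡⟨ ≡.cong (λ j → Σ< (suc k) (λ i → d i * expₛ 1ℚ (suc k ∸ i)) + d (suc k) * expₛ 1ℚ j - d (suc k)) (ℕ.n∸n≡0 k) ⟨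
      (d ⊛ expₛ 1ℚ) (suc k) - d (suc k)
        ≡⟨ ≡.cong (_- d (suc k)) (d⊛expₛ1≗d (suc k)) ⟩
      d (suc k) - d (suc k)
        ≡⟨ ℚ.+-inverseʳ (d (suc k)) ⟩
      0ℚ ∎

-- Bernoulli numbers

module BernoulliNumbers where
  open +-*-Solver
  open ≡.≡-Reasoning

  bernoulli-suc : ∀ m → bernoulli (suc m) ≡
    - (inv (nℚ (suc (suc m))) * Σℚ[ 0 , m ] (λ i → nℚ (suc (suc m) C i) * bernUpTo m i))
  bernoulli-suc m with suc m ℕ.≤? m
  ... | yes 1+m≤m = ⊥-elim (ℕ.1+n≰n 1+m≤m)
  ... | no _ = ≡.refl

  bernUpTo-correct : ∀ {m k} → k ≤ m → bernUpTo m k ≡ bernoulli k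
  bernUpTo-correct {zero} {zero} _ = ≡.refl
  bernUpTo-correct {suc m} {k} k≤1+m with k ℕ.≤? m | ℕ.m≤n⇒m<n∨m≡n k≤1+m
  ... | yes k≤m | _ = bernUpTo-correct k≤m
  ... | no k≰m | inj₁ k<1+m = ⊥-elim (k≰m (ℕ.≤-pred k<1+m))
  ... | no k≰m | inj₂ ≡.refl = ≡.sym (bernoulli-suc m)

  bernoulli-recurrence : ∀ m → Σ< (suc (suc m)) (λ k → nℚ (suc (suc m) C k) * bernoulli k) ≡ 0ℚ
  bernoulli-recurrence m = begin
    S + nℚ (suc (suc m) C suc m) * bernoulli (suc m)
      ≡⟨ ≡.cong (λ c → S + nℚ c * bernoulli (suc m)) C[m+2,m+1]≡m+2 ⟩
    S + N * bernoulli (suc m)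
      ≡⟨ ≡.cong (λ b → S + N * b) (bernoulli-suc m) ⟩
    S + N * - (inv N * Σℚ[ 0 , m ] (λ i → nℚ (suc (suc m) C i) * bernUpTo m i))
      ≡⟨ ≡.cong (λ s → S + N * - (inv N * s)) lower-terms ⟩
    S + N * - (inv N * S)
      ≡⟨ solve 3 (λ s n i → s :+ n :* (:- (i :* s)) := s :- n :* i :* s) ≡.refl S N (inv N) ⟩
    S - N * inv N * S
      ≡⟨ ≡.cong (λ x → S - x * S) (inv-inverseʳ (nℚ[1+n]≢0 (suc m))) ⟩
    S - 1ℚ * S
      ≡⟨ solve 1 (λ s → s :- con 1ℚ :* s := con 0ℚ) ≡.refl S ⟩
    0ℚ ∎
    where
    N : ℚ
    N = nℚ (suc (suc m))
    S : ℚ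
    S = Σ< (suc m) (λ k → nℚ (suc (suc m) C k) * bernoulli k)
    C[m+2,m+1]≡m+2 : suc (suc m) C suc m ≡ suc (suc m)
    C[m+2,m+1]≡m+2 = ≡.trans (nCk≡nC[n∸k] (ℕ.n≤1+n (suc m)))
      (≡.trans (≡.cong (suc (suc m) C_) (ℕ.m+n∸n≡m 1 (suc m))) (nC1≡n (suc (suc m))))
    lower-terms : Σℚ[ 0 , m ] (λ i → nℚ (suc (suc m) C i) * bernUpTo m i) ≡ S
    lower-terms = ≡.trans (sumN≡Σ 0 (suc m) _)
      (Σ-cong (suc m) (λ k k<1+m → ≡.cong (nℚ (suc (suc m) C k) *_) (bernUpTo-correct (ℕ.≤-pred k<1+m))))

module BernoulliSeries where
  open SeriesAlgebra
  open BernoulliNumbers using (bernoulli-recurrence)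
  open +-*-Solver

  𝔹 : Series
  𝔹 = egf bernoulli

  bernoulli-egf : 𝔹 ⊛ expₛ 1ℚ ≗ 𝔹 ⊞ zₛ
  bernoulli-egf zero = ≡.refl
  bernoulli-egf (suc M) = begin
    (𝔹 ⊛ expₛ 1ℚ) (suc M)
      ≡⟨ egf-⊛ bernoulli (1ℚ ^_) (suc M) ⟩
    invFact (suc M) * Σ< (suc (suc M)) (λ k → nℚ (suc M C k) * (bernoulli k * 1ℚ ^ (suc M ∸ k)))
      ≡⟨ ≡.cong (invFact (suc M) *_) (Σ-cong′ (suc (suc M)) drop-1^) ⟩
    invFact (suc M) * (Σ< (suc M) g + nℚ (suc M C suc M) * bernoulli (suc M))
      ≡⟨ ≡.cong₂ (λ s c → invFact (suc M) * (s + nℚ c * bernoulli (suc M))) (lower-terms M) (nCn≡1 (suc M)) ⟩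
    invFact (suc M) * (zₛ (suc M) + 1ℚ * bernoulli (suc M))
      ≡⟨ solve 3 (λ i z b → i :* (z :+ con 1ℚ :* b) := b :* i :+ i :* z) ≡.refl (invFact (suc M)) (zₛ (suc M)) (bernoulli (suc M)) ⟩
    𝔹 (suc M) + invFact (suc M) * zₛ (suc M)
      ≡⟨ ≡.cong (𝔹 (suc M) +_) (z-coefficient M) ⟩
    𝔹 (suc M) + zₛ (suc M) ∎
    where
    open ≡.≡-Reasoning
    g : ℕ → ℚ
    g k = nℚ (suc M C k) * bernoulli k
    drop-1^ : ∀ k → nℚ (suc M C k) * (bernoulli k * 1ℚ ^ (suc M ∸ k)) ≡ g k
    drop-1^ k = ≡.cong (λ x → nℚ (suc M C k) * x)
      (≡.trans (≡.cong (bernoulli k *_) (1^n≈1 (suc M ∸ k))) (ℚ.*-identityʳ (bernoulli k)))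
    lower-terms : ∀ M → Σ< (suc M) (λ k → nℚ (suc M C k) * bernoulli k) ≡ zₛ (suc M)
    lower-terms zero = ≡.refl
    lower-terms (suc m) = bernoulli-recurrence m
    z-coefficient : ∀ M → invFact (suc M) * zₛ (suc M) ≡ zₛ (suc M)
    z-coefficient zero = ≡.refl
    z-coefficient (suc m) = ℚ.*-zeroʳ (invFact (suc (suc m)))

  dilate-bernoulli-egf : ∀ t → dilate t 𝔹 ⊛ expₛ t ≗ dilate t 𝔹 ⊞ t · zₛ
  dilate-bernoulli-egf t = begin
    dilate t 𝔹 ⊛ expₛ t                 ≈⟨ ⊛-congˡ (dilate t 𝔹) t-exp ⟩
    dilate t 𝔹 ⊛ dilate t (expₛ 1ℚ)     ≈⟨ dilate-⊛ t 𝔹 (expₛ 1ℚ) ⟨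
    dilate t (𝔹 ⊛ expₛ 1ℚ)              ≈⟨ dilate-cong t bernoulli-egf ⟩
    dilate t (𝔹 ⊞ zₛ)                   ≈⟨ dilate-⊞ t 𝔹 zₛ ⟩
    dilate t 𝔹 ⊞ dilate t zₛ            ≈⟨ ⊞-congˡ (dilate t 𝔹) (dilate-zₛ t) ⟩
    dilate t 𝔹 ⊞ t · zₛ                 ∎
    where
    open ≗-Reasoning
    t-exp : expₛ t ≗ dilate t (expₛ 1ℚ)
    t-exp m = ≡.trans (≡.cong (λ s → expₛ s m) (≡.sym (ℚ.*-identityʳ t))) (≡.sym (dilate-expₛ t 1ℚ m))

  bernoulli-reflect : dilate (- 1ℚ) 𝔹 ≗ 𝔹 ⊞ zₛ
  bernoulli-reflect = ⊛expₛ1-unique {c = zₛ ⊛ expₛ 1ℚ} reflected shifted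
    where
    B⁻ : Series
    B⁻ = dilate (- 1ℚ) 𝔹
    undo : B⁻ ≗ B⁻ ⊛ expₛ 1ℚ ⊞ (- 1ℚ) · (zₛ ⊛ expₛ 1ℚ)
    undo = begin
      B⁻                                         ≈⟨ ⊛-expₛ0 B⁻ ⟨
      B⁻ ⊛ expₛ 0ℚ                               ≈⟨ ⊛-congˡ B⁻ (expₛ-⊛ (- 1ℚ) 1ℚ) ⟨
      B⁻ ⊛ (expₛ (- 1ℚ) ⊛ expₛ 1ℚ)               ≈⟨ ⊛-assoc B⁻ (expₛ (- 1ℚ)) (expₛ 1ℚ) ⟨
      (B⁻ ⊛ expₛ (- 1ℚ)) ⊛ expₛ 1ℚ               ≈⟨ ⊛-congʳ (expₛ 1ℚ) (dilate-bernoulli-egf (- 1ℚ)) ⟩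
      (B⁻ ⊞ (- 1ℚ) · zₛ) ⊛ expₛ 1ℚ               ≈⟨ ⊛-distribʳ-⊞ B⁻ ((- 1ℚ) · zₛ) (expₛ 1ℚ) ⟩
      B⁻ ⊛ expₛ 1ℚ ⊞ ((- 1ℚ) · zₛ) ⊛ expₛ 1ℚ     ≈⟨ ⊞-congˡ (B⁻ ⊛ expₛ 1ℚ) (·-⊛ (- 1ℚ) zₛ (expₛ 1ℚ)) ⟩
      B⁻ ⊛ expₛ 1ℚ ⊞ (- 1ℚ) · (zₛ ⊛ expₛ 1ℚ)     ∎
      where open ≗-Reasoning
    reflected : B⁻ ⊛ expₛ 1ℚ ≗ B⁻ ⊞ zₛ ⊛ expₛ 1ℚ
    reflected m = ≡.trans
      (solve 2 (λ x y → x := x :+ con (- 1ℚ) :* y :+ y) ≡.refl ((B⁻ ⊛ expₛ 1ℚ) m) ((zₛ ⊛ expₛ 1ℚ) m))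
      (≡.cong (_+ (zₛ ⊛ expₛ 1ℚ) m) (≡.sym (undo m)))
    shifted : (𝔹 ⊞ zₛ) ⊛ expₛ 1ℚ ≗ (𝔹 ⊞ zₛ) ⊞ zₛ ⊛ expₛ 1ℚ
    shifted m = ≡.trans (⊛-distribʳ-⊞ 𝔹 zₛ (expₛ 1ℚ) m) (≡.cong (_+ (zₛ ⊛ expₛ 1ℚ) m) (bernoulli-egf m))

  z/sinh : Series
  z/sinh = dilate (nℚ 2) 𝔹 ⊛ expₛ 1ℚ

  z/sinh-even : dilate (- 1ℚ) z/sinh ≗ z/sinh
  z/sinh-even = begin
    dilate (- 1ℚ) (B₂ ⊛ expₛ 1ℚ)                  ≈⟨ dilate-⊛ (- 1ℚ) B₂ (expₛ 1ℚ) ⟩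
    dilate (- 1ℚ) B₂ ⊛ dilate (- 1ℚ) (expₛ 1ℚ)
      ≈⟨ ⊛-cong (≗.trans (dilate-dilate (- 1ℚ) (nℚ 2) 𝔹) (≗.sym (dilate-dilate (nℚ 2) (- 1ℚ) 𝔹))) (dilate-expₛ (- 1ℚ) 1ℚ) ⟩
    dilate (nℚ 2) (dilate (- 1ℚ) 𝔹) ⊛ expₛ (- 1ℚ) ≈⟨ ⊛-congʳ (expₛ (- 1ℚ)) (dilate-cong (nℚ 2) bernoulli-reflect) ⟩
    dilate (nℚ 2) (𝔹 ⊞ zₛ) ⊛ expₛ (- 1ℚ)
      ≈⟨ ⊛-congʳ (expₛ (- 1ℚ)) (≗.trans (dilate-⊞ (nℚ 2) 𝔹 zₛ) (⊞-congˡ B₂ (dilate-zₛ (nℚ 2)))) ⟩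
    (B₂ ⊞ nℚ 2 · zₛ) ⊛ expₛ (- 1ℚ)                ≈⟨ ⊛-congʳ (expₛ (- 1ℚ)) (dilate-bernoulli-egf (nℚ 2)) ⟨
    (B₂ ⊛ expₛ (nℚ 2)) ⊛ expₛ (- 1ℚ)              ≈⟨ ⊛-assoc B₂ (expₛ (nℚ 2)) (expₛ (- 1ℚ)) ⟩
    B₂ ⊛ (expₛ (nℚ 2) ⊛ expₛ (- 1ℚ))              ≈⟨ ⊛-congˡ B₂ (expₛ-⊛ (nℚ 2) (- 1ℚ)) ⟩
    B₂ ⊛ expₛ 1ℚ                                  ∎
    where
    open ≗-Reasoning
    B₂ : Series
    B₂ = dilate (nℚ 2) 𝔹

  bernoulli-duplication : dilate (nℚ 2) 𝔹 ⊛ (expₛ 1ℚ ⊞ expₛ 0ℚ) ≗ nℚ 2 · 𝔹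
  bernoulli-duplication = ⊛expₛ1-unique {c = nℚ 2 · zₛ} lhs rhs
    where
    B₂ : Series
    B₂ = dilate (nℚ 2) 𝔹
    Y : Series
    Y = B₂ ⊛ (expₛ 1ℚ ⊞ expₛ 0ℚ)
    Y≗ : Y ≗ z/sinh ⊞ B₂
    Y≗ = ≗.trans (⊛-distribˡ-⊞ B₂ (expₛ 1ℚ) (expₛ 0ℚ)) (⊞-congˡ z/sinh (⊛-expₛ0 B₂))
    Y⊛expₛ1 : Y ⊛ expₛ 1ℚ ≗ (B₂ ⊞ nℚ 2 · zₛ) ⊞ z/sinh
    Y⊛expₛ1 = begin
      Y ⊛ expₛ 1ℚ                                        ≈⟨ ⊛-assoc B₂ (expₛ 1ℚ ⊞ expₛ 0ℚ) (expₛ 1ℚ) ⟩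
      B₂ ⊛ ((expₛ 1ℚ ⊞ expₛ 0ℚ) ⊛ expₛ 1ℚ)
        ≈⟨ ⊛-congˡ B₂ (≗.trans (⊛-distribʳ-⊞ (expₛ 1ℚ) (expₛ 0ℚ) (expₛ 1ℚ)) (⊞-cong (expₛ-⊛ 1ℚ 1ℚ) (expₛ-⊛ 0ℚ 1ℚ))) ⟩
      B₂ ⊛ (expₛ (nℚ 2) ⊞ expₛ 1ℚ)                       ≈⟨ ⊛-distribˡ-⊞ B₂ (expₛ (nℚ 2)) (expₛ 1ℚ) ⟩
      B₂ ⊛ expₛ (nℚ 2) ⊞ z/sinh                           ≈⟨ ⊞-congʳ z/sinh (dilate-bernoulli-egf (nℚ 2)) ⟩
      (B₂ ⊞ nℚ 2 · zₛ) ⊞ z/sinh                           ∎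
      where open ≗-Reasoning
    lhs : Y ⊛ expₛ 1ℚ ≗ Y ⊞ nℚ 2 · zₛ
    lhs m = ≡.trans (Y⊛expₛ1 m) (≡.trans
      (solve 3 (λ b z g → b :+ z :+ g := g :+ b :+ z) ≡.refl (B₂ m) (nℚ 2 * zₛ m) (z/sinh m))
      (≡.cong (_+ nℚ 2 * zₛ m) (≡.sym (Y≗ m))))
    rhs : (nℚ 2 · 𝔹) ⊛ expₛ 1ℚ ≗ nℚ 2 · 𝔹 ⊞ nℚ 2 · zₛ
    rhs m = ≡.trans (·-⊛ (nℚ 2) 𝔹 (expₛ 1ℚ) m)
      (≡.trans (≡.cong (nℚ 2 *_) (bernoulli-egf m)) (ℚ.*-distribˡ-+ (nℚ 2) (𝔹 m) (zₛ m)))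

  z/cosh : Series
  z/cosh = z/sinh ⊟ dilate (nℚ 4) 𝔹 ⊛ expₛ 1ℚ

  z/cosh-times-2cosh : z/cosh ⊛ (expₛ 1ℚ ⊞ expₛ (- 1ℚ)) ≗ nℚ 2 · zₛ
  z/cosh-times-2cosh = begin
    z/cosh ⊛ C                                  ≈⟨ ⊛-distribʳ-⊟ z/sinh (B₄ ⊛ expₛ 1ℚ) C ⟩
    z/sinh ⊛ C ⊟ (B₄ ⊛ expₛ 1ℚ) ⊛ C            ≈⟨ ⊟-cong sinh-part cosh-part ⟩
    (B₂ ⊞ nℚ 2 · zₛ ⊞ B₂) ⊟ nℚ 2 · B₂
      ≈⟨ (λ m → solve 2 (λ b z → b :+ con (nℚ 2) :* z :+ b :- con (nℚ 2) :* b := con (nℚ 2) :* z) ≡.refl (B₂ m) (zₛ m)) ⟩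
    nℚ 2 · zₛ                                   ∎
    where
    open ≗-Reasoning
    B₂ : Series
    B₂ = dilate (nℚ 2) 𝔹
    B₄ : Series
    B₄ = dilate (nℚ 4) 𝔹
    C : Series
    C = expₛ 1ℚ ⊞ expₛ (- 1ℚ)
    expₛ1⊛C : expₛ 1ℚ ⊛ C ≗ expₛ (nℚ 2) ⊞ expₛ 0ℚ
    expₛ1⊛C = ≗.trans (⊛-distribˡ-⊞ (expₛ 1ℚ) (expₛ 1ℚ) (expₛ (- 1ℚ))) (⊞-cong (expₛ-⊛ 1ℚ 1ℚ) (expₛ-⊛ 1ℚ (- 1ℚ)))
    sinh-part : z/sinh ⊛ C ≗ B₂ ⊞ nℚ 2 · zₛ ⊞ B₂
    sinh-part = begin
      (B₂ ⊛ expₛ 1ℚ) ⊛ C                  ≈⟨ ⊛-assoc B₂ (expₛ 1ℚ) C ⟩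
      B₂ ⊛ (expₛ 1ℚ ⊛ C)                  ≈⟨ ⊛-congˡ B₂ expₛ1⊛C ⟩
      B₂ ⊛ (expₛ (nℚ 2) ⊞ expₛ 0ℚ)        ≈⟨ ⊛-distribˡ-⊞ B₂ (expₛ (nℚ 2)) (expₛ 0ℚ) ⟩
      B₂ ⊛ expₛ (nℚ 2) ⊞ B₂ ⊛ expₛ 0ℚ     ≈⟨ ⊞-cong (dilate-bernoulli-egf (nℚ 2)) (⊛-expₛ0 B₂) ⟩
      B₂ ⊞ nℚ 2 · zₛ ⊞ B₂                 ∎
    cosh-part : (B₄ ⊛ expₛ 1ℚ) ⊛ C ≗ nℚ 2 · B₂
    cosh-part = begin
      (B₄ ⊛ expₛ 1ℚ) ⊛ C                                 ≈⟨ ⊛-assoc B₄ (expₛ 1ℚ) C ⟩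
      B₄ ⊛ (expₛ 1ℚ ⊛ C)                                 ≈⟨ ⊛-congˡ B₄ expₛ1⊛C ⟩
      B₄ ⊛ (expₛ (nℚ 2) ⊞ expₛ 0ℚ)
        ≈⟨ ⊛-cong (≗.sym (dilate-dilate (nℚ 2) (nℚ 2) 𝔹)) (≗.sym (≗.trans (dilate-⊞ (nℚ 2) (expₛ 1ℚ) (expₛ 0ℚ)) (⊞-cong (dilate-expₛ (nℚ 2) 1ℚ) (dilate-expₛ (nℚ 2) 0ℚ)))) ⟩
      dilate (nℚ 2) B₂ ⊛ dilate (nℚ 2) (expₛ 1ℚ ⊞ expₛ 0ℚ) ≈⟨ dilate-⊛ (nℚ 2) B₂ (expₛ 1ℚ ⊞ expₛ 0ℚ) ⟨
      dilate (nℚ 2) (B₂ ⊛ (expₛ 1ℚ ⊞ expₛ 0ℚ))          ≈⟨ dilate-cong (nℚ 2) bernoulli-duplication ⟩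
      dilate (nℚ 2) (nℚ 2 · 𝔹)                           ≈⟨ dilate-· (nℚ 2) (nℚ 2) 𝔹 ⟩
      nℚ 2 · B₂                                          ∎

  z/cosh-odd : z/cosh ⊞ dilate (- 1ℚ) z/cosh ≗ 𝟘
  z/cosh-odd = ⊛-cancelʳ-𝟘 {c = C} (λ ()) (begin
    (z/cosh ⊞ dilate (- 1ℚ) z/cosh) ⊛ C              ≈⟨ ⊛-distribʳ-⊞ z/cosh (dilate (- 1ℚ) z/cosh) C ⟩
    z/cosh ⊛ C ⊞ dilate (- 1ℚ) z/cosh ⊛ C            ≈⟨ ⊞-cong z/cosh-times-2cosh reflected ⟩
    nℚ 2 · zₛ ⊞ nℚ 2 · (- 1ℚ · zₛ)
      ≈⟨ (λ m → solve 1 (λ z → con (nℚ 2) :* z :+ con (nℚ 2) :* (con (- 1ℚ) :* z) := con 0ℚ) ≡.refl (zₛ m)) ⟩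
    𝟘                                                ∎)
    where
    open ≗-Reasoning
    C : Series
    C = expₛ 1ℚ ⊞ expₛ (- 1ℚ)
    C-even : C ≗ dilate (- 1ℚ) C
    C-even k = ≡.trans (ℚ.+-comm (expₛ 1ℚ k) (expₛ (- 1ℚ) k))
      (≡.sym (≡.trans (dilate-⊞ (- 1ℚ) (expₛ 1ℚ) (expₛ (- 1ℚ)) k) (≡.cong₂ _+_ (dilate-expₛ (- 1ℚ) 1ℚ k) (dilate-expₛ (- 1ℚ) (- 1ℚ) k))))
    reflected : dilate (- 1ℚ) z/cosh ⊛ C ≗ nℚ 2 · (- 1ℚ · zₛ)
    reflected = begin
      dilate (- 1ℚ) z/cosh ⊛ C                   ≈⟨ ⊛-congˡ (dilate (- 1ℚ) z/cosh) C-even ⟩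
      dilate (- 1ℚ) z/cosh ⊛ dilate (- 1ℚ) C     ≈⟨ dilate-⊛ (- 1ℚ) z/cosh C ⟨
      dilate (- 1ℚ) (z/cosh ⊛ C)                 ≈⟨ dilate-cong (- 1ℚ) z/cosh-times-2cosh ⟩
      dilate (- 1ℚ) (nℚ 2 · zₛ)                  ≈⟨ ≗.trans (dilate-· (- 1ℚ) (nℚ 2) zₛ) (λ k → ≡.cong (nℚ 2 *_) (dilate-zₛ (- 1ℚ) k)) ⟩
      nℚ 2 · (- 1ℚ · zₛ)                         ∎

  dilate-𝔹⊛expₛ1-coefficient : ∀ s m →
    (dilate s 𝔹 ⊛ expₛ 1ℚ) m ≡ invFact m * Σ< (suc m) (λ k → nℚ (m C k) * (s ^ k * bernoulli k))
  dilate-𝔹⊛expₛ1-coefficient s m = begin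
    (dilate s 𝔹 ⊛ expₛ 1ℚ) m
      ≡⟨ ⊛-congʳ (expₛ 1ℚ) (λ k → ℚ.*-assoc (s ^ k) (bernoulli k) (invFact k)) m ⟨
    (egf (λ k → s ^ k * bernoulli k) ⊛ egf (1ℚ ^_)) m
      ≡⟨ egf-⊛ (λ k → s ^ k * bernoulli k) (1ℚ ^_) m ⟩
    invFact m * Σ< (suc m) (λ k → nℚ (m C k) * (s ^ k * bernoulli k * 1ℚ ^ (m ∸ k)))
      ≡⟨ ≡.cong (invFact m *_) (Σ-cong′ (suc m) drop-1^) ⟩
    invFact m * Σ< (suc m) (λ k → nℚ (m C k) * (s ^ k * bernoulli k)) ∎
    where
    open ≡.≡-Reasoning
    drop-1^ : ∀ k → nℚ (m C k) * (s ^ k * bernoulli k * 1ℚ ^ (m ∸ k)) ≡ nℚ (m C k) * (s ^ k * bernoulli k)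
    drop-1^ k = ≡.cong (nℚ (m C k) *_) (≡.trans (≡.cong (s ^ k * bernoulli k *_) (1^n≈1 (m ∸ k))) (ℚ.*-identityʳ _))

  bernoulli-odd : ∀ p → bernoulli (suc (suc (suc (p ℕ.+ p)))) ≡ 0ℚ
  bernoulli-odd p = *≡0⇒≡0 (invFact≢0 M) (x+x≡0⇒x≡0 (begin
    𝔹 M + 𝔹 M                        ≡⟨ ≡.cong (_+ 𝔹 M) (≡.trans (bernoulli-reflect M) (ℚ.+-identityʳ (𝔹 M))) ⟨
    (- 1ℚ) ^ M * 𝔹 M + 𝔹 M
      ≡⟨ ≡.cong (λ s → s * 𝔹 M + 𝔹 M) (≡.trans (≡.cong (λ i → (- 1ℚ) ^ suc (suc i)) (≡.sym (ℕ.+-suc p p))) (-1^[1+p+p]≡-1 (suc p))) ⟩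
    - 1ℚ * 𝔹 M + 𝔹 M                 ≡⟨ solve 1 (λ x → con (- 1ℚ) :* x :+ x := con 0ℚ) ≡.refl (𝔹 M) ⟩
    0ℚ                               ∎))
    where
    open ≡.≡-Reasoning
    M : ℕ
    M = suc (suc (suc (p ℕ.+ p)))

  binomial-2^k-bernoulli-odd : ∀ p → Σ< (suc (suc (p ℕ.+ p))) (λ k → nℚ (suc (p ℕ.+ p) C k) * (nℚ 2 ^ k * bernoulli k)) ≡ 0ℚ
  binomial-2^k-bernoulli-odd p = invFact*≡0 (suc (p ℕ.+ p)) (≡.trans (≡.sym (dilate-𝔹⊛expₛ1-coefficient (nℚ 2) (suc (p ℕ.+ p))))
    (even⇒odd-coefficients-vanish {z/sinh} z/sinh-even p))

  binomial-2^k-4^k-bernoulli-even : ∀ p → Σ< (suc (p ℕ.+ p)) (λ k → nℚ ((p ℕ.+ p) C k) * ((nℚ 2 ^ k - nℚ 4 ^ k) * bernoulli k)) ≡ 0ℚ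
  binomial-2^k-4^k-bernoulli-even p = invFact*≡0 (p ℕ.+ p) (begin
    invFact M * Σ< (suc M) (λ k → nℚ (M C k) * ((nℚ 2 ^ k - nℚ 4 ^ k) * bernoulli k))
      ≡⟨ ≡.cong (invFact M *_) (≡.trans (Σ-cong′ (suc M) split) (Σ-distrib-- (suc M) (S (nℚ 2)) (S (nℚ 4)))) ⟩
    invFact M * (Σ< (suc M) (S (nℚ 2)) - Σ< (suc M) (S (nℚ 4)))
      ≡⟨ solve 3 (λ i x y → i :* (x :- y) := i :* x :- i :* y) ≡.refl (invFact M) _ _ ⟩
    invFact M * Σ< (suc M) (S (nℚ 2)) - invFact M * Σ< (suc M) (S (nℚ 4))
      ≡⟨ ≡.cong₂ _-_ (dilate-𝔹⊛expₛ1-coefficient (nℚ 2) M) (dilate-𝔹⊛expₛ1-coefficient (nℚ 4) M) ⟨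
    z/cosh M
      ≡⟨ odd⇒even-coefficients-vanish {z/cosh} z/cosh-odd p ⟩
    0ℚ ∎)
    where
    open ≡.≡-Reasoning
    M : ℕ
    M = p ℕ.+ p
    S : ℚ → ℕ → ℚ
    S s k = nℚ (M C k) * (s ^ k * bernoulli k)
    split : ∀ k → nℚ (M C k) * ((nℚ 2 ^ k - nℚ 4 ^ k) * bernoulli k) ≡ S (nℚ 2) k - S (nℚ 4) k
    split k = solve 4 (λ c x y b → c :* ((x :- y) :* b) := c :* (x :* b) :- c :* (y :* b)) ≡.refl (nℚ (M C k)) (nℚ 2 ^ k) (nℚ 4 ^ k) (bernoulli k)

  bernoulli-sum-over-[n∸k+1] : ∀ {n} p → n ≡ suc (suc (p ℕ.+ p)) →
    Σ< (suc n) (λ k → nℚ (n C k) * nℚ (2 ℕ.^ k) * inv (nℚ (n ∸ k ℕ.+ 1)) * bernoulli k) ≡ 0ℚ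
  bernoulli-sum-over-[n∸k+1] {n} p ≡.refl = begin
    Σ< (suc n) (λ k → nℚ (n C k) * nℚ (2 ℕ.^ k) * inv (nℚ (n ∸ k ℕ.+ 1)) * bernoulli k)
      ≡⟨ Σ-cong (suc n) (λ k k<1+n → absorb k (ℕ.≤-pred k<1+n)) ⟩
    Σ< N (λ k → inv (nℚ N) * f k)
      ≡⟨ *-distribˡ-Σ N (inv (nℚ N)) f ⟨
    inv (nℚ N) * Σ< N f
      ≡⟨ ≡.cong (inv (nℚ N) *_) (solve 2 (λ s t → s := s :+ t :- t) ≡.refl (Σ< N f) (f N)) ⟩
    inv (nℚ N) * (Σ< (suc N) f - f N)
      ≡⟨ ≡.cong₂ (λ s b → inv (nℚ N) * (s - nℚ (N C N) * (nℚ 2 ^ N * b))) all-terms (bernoulli-odd p) ⟩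
    inv (nℚ N) * (0ℚ - nℚ (N C N) * (nℚ 2 ^ N * 0ℚ))
      ≡⟨ solve 3 (λ i c t → i :* (con 0ℚ :- c :* (t :* con 0ℚ)) := con 0ℚ) ≡.refl (inv (nℚ N)) (nℚ (N C N)) (nℚ 2 ^ N) ⟩
    0ℚ ∎
    where
    open ≡.≡-Reasoning
    N : ℕ
    N = suc n
    f : ℕ → ℚ
    f k = nℚ (N C k) * (nℚ 2 ^ k * bernoulli k)
    all-terms : Σ< (suc N) f ≡ 0ℚ
    all-terms = ≡.trans (≡.cong (λ i → Σ< (suc (suc i)) (λ k → nℚ (suc i C k) * (nℚ 2 ^ k * bernoulli k))) (≡.sym (≡.cong suc (ℕ.+-suc p p))))
      (binomial-2^k-bernoulli-odd (suc p))
    absorb : ∀ k → k ≤ n → nℚ (n C k) * nℚ (2 ℕ.^ k) * inv (nℚ (n ∸ k ℕ.+ 1)) * bernoulli k ≡ inv (nℚ N) * f k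
    absorb k k≤n = begin
      nℚ (n C k) * nℚ (2 ℕ.^ k) * inv (nℚ (n ∸ k ℕ.+ 1)) * bernoulli k
        ≡⟨ solve 4 (λ c t i b → c :* t :* i :* b := c :* i :* (t :* b)) ≡.refl (nℚ (n C k)) (nℚ (2 ℕ.^ k)) (inv (nℚ (n ∸ k ℕ.+ 1))) (bernoulli k) ⟩
      nℚ (n C k) * inv (nℚ (n ∸ k ℕ.+ 1)) * (nℚ (2 ℕ.^ k) * bernoulli k)
        ≡⟨ ≡.cong₂ (λ x t → x * (t * bernoulli k)) (C/[n∸k+1] k≤n) (nℚ-^ 2 k) ⟩
      nℚ (N C k) * inv (nℚ N) * (nℚ 2 ^ k * bernoulli k)
        ≡⟨ solve 3 (λ c i x → c :* i :* x := i :* (c :* x)) ≡.refl (nℚ (N C k)) (inv (nℚ N)) (nℚ 2 ^ k * bernoulli k) ⟩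
      inv (nℚ N) * f k ∎

  binomial-2^k-4^k-bernoulli-from-2 : ∀ {m} p → m ≡ suc (suc (suc (suc (p ℕ.+ p)))) →
    Σ< (suc (m ∸ 2)) (λ k → nℚ (m C suc (suc k)) * ((nℚ 2 ^ suc (suc k) - nℚ 4 ^ suc (suc k)) * bernoulli (suc (suc k))))
      ≡ - nℚ m
  binomial-2^k-4^k-bernoulli-from-2 {m} p ≡.refl = begin
    upper
      ≡⟨ solve 2 (λ u m → u := m :+ (con 0ℚ :+ (m :+ u)) :- m :- m) ≡.refl upper (nℚ m) ⟩
    nℚ m + (0ℚ + (nℚ m + upper)) - nℚ m - nℚ m
      ≡⟨ ≡.cong (λ x → nℚ m + x - nℚ m - nℚ m) (≡.cong₂ (λ q₀ q₁ → q₀ + (q₁ + upper)) Q₀ Q₁) ⟨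
    nℚ m + (Q 0 + (Q 1 + upper)) - nℚ m - nℚ m
      ≡⟨ ≡.cong (λ x → nℚ m + x - nℚ m - nℚ m) (≡.trans (Σ-head (suc (suc n)) Q) (≡.cong (Q 0 +_) (Σ-head (suc n) (λ k → Q (suc k))))) ⟨
    nℚ m + Σ< (suc m) Q - nℚ m - nℚ m
      ≡⟨ ≡.cong (λ x → nℚ m + x - nℚ m - nℚ m) all-terms ⟩
    nℚ m + 0ℚ - nℚ m - nℚ m
      ≡⟨ solve 1 (λ m → m :+ con 0ℚ :- m :- m := :- m) ≡.refl (nℚ m) ⟩
    - nℚ m ∎
    where
    open ≡.≡-Reasoning
    n : ℕ
    n = suc (suc (p ℕ.+ p))
    Q : ℕ → ℚ
    Q i = nℚ (m C i) * ((nℚ 2 ^ i - nℚ 4 ^ i) * bernoulli i)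
    upper : ℚ
    upper = Σ< (suc n) (λ k → Q (suc (suc k)))
    m≡q+q : ∀ p → suc (suc (suc (suc (p ℕ.+ p)))) ≡ suc (suc p) ℕ.+ suc (suc p)
    m≡q+q = solve-∀
    all-terms : Σ< (suc m) Q ≡ 0ℚ
    all-terms = ≡.trans (≡.cong (λ i → Σ< (suc i) (λ k → nℚ (i C k) * ((nℚ 2 ^ k - nℚ 4 ^ k) * bernoulli k))) (m≡q+q p))
      (binomial-2^k-4^k-bernoulli-even (suc (suc p)))
    Q₀ : Q 0 ≡ 0ℚ
    Q₀ = solve 1 (λ c → c :* ((con 1ℚ :- con 1ℚ) :* con 1ℚ) := con 0ℚ) ≡.refl (nℚ (m C 0))
    Q₁ : Q 1 ≡ nℚ m
    Q₁ = ≡.trans (≡.cong (λ x → nℚ x * ((nℚ 2 ^ 1 - nℚ 4 ^ 1) * bernoulli 1)) (nC1≡n m))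
      (solve 1 (λ x → x :* ((con (nℚ 2 ^ 1) :- con (nℚ 4 ^ 1)) :* con (bernoulli 1)) := x) ≡.refl (nℚ m))

  bernoulli-sum-over-[k+1][k+2] : ∀ {n} p → n ≡ suc (suc (p ℕ.+ p)) →
    Σ< (suc n) (λ k → nℚ (n C k) * nℚ (2 ℕ.^ k) * inv (nℚ (k ℕ.+ 1))
                      * ((nℚ (2 ℕ.^ (k ℕ.+ 3)) - nℚ 2) * inv (nℚ (k ℕ.+ 2))) * bernoulli (k ℕ.+ 2))
      ≡ inv (nℚ 2 * nℚ (suc n))
  bernoulli-sum-over-[k+1][k+2] {n} p ≡.refl = begin
    Σ< (suc n) term
      ≡⟨ Σ-cong (suc n) (λ k k<1+n → term≡ k (ℕ.≤-pred k<1+n)) ⟩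
    Σ< (suc n) (λ k → c * - Q (suc (suc k)))
      ≡⟨ *-distribˡ-Σ (suc n) c (λ k → - Q (suc (suc k))) ⟨
    c * Σ< (suc n) (λ k → - Q (suc (suc k)))
      ≡⟨ ≡.cong (c *_) (≡.trans (Σ-neg (suc n) (λ k → Q (suc (suc k))))
                                (≡.cong -_ (binomial-2^k-4^k-bernoulli-from-2 p ≡.refl))) ⟩
    c * - - nℚ M
      ≡⟨ solve 4 (λ a b c m → a :* (b :* c) :* (:- (:- m)) := a :* b :* (c :* m)) ≡.refl (inv (nℚ 2)) (inv (nℚ (suc n))) (inv (nℚ M)) (nℚ M) ⟩
    inv (nℚ 2) * inv (nℚ (suc n)) * (inv (nℚ M) * nℚ M)
      ≡⟨ ≡.cong₂ _*_ (inv-distrib-* {nℚ 2} (λ ()) (nℚ[1+n]≢0 n)) (≡.sym (inv-inverseˡ (nℚ[1+n]≢0 (suc n)))) ⟨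
    inv (nℚ 2 * nℚ (suc n)) * 1ℚ
      ≡⟨ ℚ.*-identityʳ _ ⟩
    inv (nℚ 2 * nℚ (suc n)) ∎
    where
    open ≡.≡-Reasoning
    M : ℕ
    M = suc (suc n)
    term Q : ℕ → ℚ
    term k = nℚ (n C k) * nℚ (2 ℕ.^ k) * inv (nℚ (k ℕ.+ 1))
             * ((nℚ (2 ℕ.^ (k ℕ.+ 3)) - nℚ 2) * inv (nℚ (k ℕ.+ 2))) * bernoulli (k ℕ.+ 2)
    Q i = nℚ (M C i) * ((nℚ 2 ^ i - nℚ 4 ^ i) * bernoulli i)
    c : ℚ
    c = inv (nℚ 2) * (inv (nℚ (suc n)) * inv (nℚ M))
    term≡ : ∀ k → k ≤ n → term k ≡ c * - Q (suc (suc k))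
    term≡ k k≤n = begin
      term k
        ≡⟨ ≡.cong₂ (λ i j → nℚ (n C k) * a * inv (nℚ i) * ((b - nℚ 2) * inv (nℚ j)) * bernoulli j) (ℕ.+-comm k 1) (ℕ.+-comm k 2) ⟩
      nℚ (n C k) * a * inv (nℚ (suc k)) * ((b - nℚ 2) * inv (nℚ (suc (suc k)))) * B
        ≡⟨ solve 6 (λ c a i b j x → c :* a :* i :* ((b :- con (nℚ 2)) :* j) :* x
                                 := c :* (i :* j) :* (a :* (b :- con (nℚ 2))) :* x) ≡.refl
             (nℚ (n C k)) a (inv (nℚ (suc k))) b (inv (nℚ (suc (suc k)))) B ⟩
      nℚ (n C k) * (inv (nℚ (suc k)) * inv (nℚ (suc (suc k)))) * (a * (b - nℚ 2)) * B
        ≡⟨ ≡.cong₂ (λ x y → x * y * B) (C/[1+k][2+k] k≤n) (2^k[2^[k+3]-2]≡[4^[2+k]-2^[2+k]]/2 k) ⟩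
      nℚ (M C suc (suc k)) * (inv (nℚ (suc n)) * inv (nℚ M)) * ((nℚ 4 ^ suc (suc k) - nℚ 2 ^ suc (suc k)) * inv (nℚ 2)) * B
        ≡⟨ solve 7 (λ c i j u v h x → c :* (i :* j) :* ((u :- v) :* h) :* x := h :* (i :* j) :* (:- (c :* ((v :- u) :* x)))) ≡.refl
             (nℚ (M C suc (suc k))) (inv (nℚ (suc n))) (inv (nℚ M)) (nℚ 4 ^ suc (suc k)) (nℚ 2 ^ suc (suc k)) (inv (nℚ 2)) B ⟩
      c * - Q (suc (suc k)) ∎
      where
      a b B : ℚ
      a = nℚ (2 ℕ.^ k)
      b = nℚ (2 ℕ.^ (k ℕ.+ 3))
      B = bernoulli (suc (suc k))

-- The field ℚ(√5)

⊝_ : Q5 → Q5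
⊝ q5 a b = q5 (- a) (- b)

module Q5Ring where
  open +-*-Solver

  private
    q5-cong : ∀ {a b c d} → a ≡ c → b ≡ d → q5 a b ≡ q5 c d
    q5-cong = ≡.cong₂ q5

  ⊕-assoc : ∀ x y z → (x ⊕ y) ⊕ z ≡ x ⊕ (y ⊕ z)
  ⊕-assoc (q5 a b) (q5 c d) (q5 e f) = q5-cong (ℚ.+-assoc a c e) (ℚ.+-assoc b d f)

  ⊕-comm : ∀ x y → x ⊕ y ≡ y ⊕ x
  ⊕-comm (q5 a b) (q5 c d) = q5-cong (ℚ.+-comm a c) (ℚ.+-comm b d)

  ⊕-identityˡ : ∀ x → ι 0ℚ ⊕ x ≡ x
  ⊕-identityˡ (q5 a b) = q5-cong (ℚ.+-identityˡ a) (ℚ.+-identityˡ b)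

  ⊕-identityʳ : ∀ x → x ⊕ ι 0ℚ ≡ x
  ⊕-identityʳ (q5 a b) = q5-cong (ℚ.+-identityʳ a) (ℚ.+-identityʳ b)

  ⊝-inverseˡ : ∀ x → (⊝ x) ⊕ x ≡ ι 0ℚ
  ⊝-inverseˡ (q5 a b) = q5-cong (ℚ.+-inverseˡ a) (ℚ.+-inverseˡ b)

  ⊝-inverseʳ : ∀ x → x ⊕ (⊝ x) ≡ ι 0ℚ
  ⊝-inverseʳ (q5 a b) = q5-cong (ℚ.+-inverseʳ a) (ℚ.+-inverseʳ b)

  ⊗-assoc : ∀ x y z → (x ⊗ y) ⊗ z ≡ x ⊗ (y ⊗ z)
  ⊗-assoc (q5 a b) (q5 c d) (q5 e f) = q5-cong
    (solve 6 (λ a b c d e f → (a :* c :+ con (nℚ 5) :* (b :* d)) :* e :+ con (nℚ 5) :* ((a :* d :+ b :* c) :* f)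
       := a :* (c :* e :+ con (nℚ 5) :* (d :* f)) :+ con (nℚ 5) :* (b :* (c :* f :+ d :* e))) ≡.refl a b c d e f)
    (solve 6 (λ a b c d e f → (a :* c :+ con (nℚ 5) :* (b :* d)) :* f :+ (a :* d :+ b :* c) :* e
       := a :* (c :* f :+ d :* e) :+ b :* (c :* e :+ con (nℚ 5) :* (d :* f))) ≡.refl a b c d e f)

  ⊗-comm : ∀ x y → x ⊗ y ≡ y ⊗ x
  ⊗-comm (q5 a b) (q5 c d) = q5-cong
    (solve 4 (λ a b c d → a :* c :+ con (nℚ 5) :* (b :* d) := c :* a :+ con (nℚ 5) :* (d :* b)) ≡.refl a b c d)
    (solve 4 (λ a b c d → a :* d :+ b :* c := c :* b :+ d :* a) ≡.refl a b c d)

  ⊗-identityˡ : ∀ x → ι 1ℚ ⊗ x ≡ x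
  ⊗-identityˡ (q5 a b) = q5-cong
    (solve 2 (λ a b → con 1ℚ :* a :+ con (nℚ 5) :* (con 0ℚ :* b) := a) ≡.refl a b)
    (solve 2 (λ a b → con 1ℚ :* b :+ con 0ℚ :* a := b) ≡.refl a b)

  ⊗-identityʳ : ∀ x → x ⊗ ι 1ℚ ≡ x
  ⊗-identityʳ x = ≡.trans (⊗-comm x (ι 1ℚ)) (⊗-identityˡ x)

  ⊗-distribˡ-⊕ : ∀ x y z → x ⊗ (y ⊕ z) ≡ (x ⊗ y) ⊕ (x ⊗ z)
  ⊗-distribˡ-⊕ (q5 a b) (q5 c d) (q5 e f) = q5-cong
    (solve 6 (λ a b c d e f → a :* (c :+ e) :+ con (nℚ 5) :* (b :* (d :+ f))
       := (a :* c :+ con (nℚ 5) :* (b :* d)) :+ (a :* e :+ con (nℚ 5) :* (b :* f))) ≡.refl a b c d e f)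
    (solve 6 (λ a b c d e f → a :* (d :+ f) :+ b :* (c :+ e)
       := (a :* d :+ b :* c) :+ (a :* f :+ b :* e)) ≡.refl a b c d e f)

  ⊗-zeroˡ : ∀ x → ι 0ℚ ⊗ x ≡ ι 0ℚ
  ⊗-zeroˡ (q5 a b) = q5-cong
    (solve 2 (λ a b → con 0ℚ :* a :+ con (nℚ 5) :* (con 0ℚ :* b) := con 0ℚ) ≡.refl a b)
    (solve 2 (λ a b → con 0ℚ :* b :+ con 0ℚ :* a := con 0ℚ) ≡.refl a b)

  ⊗-zeroʳ : ∀ x → x ⊗ ι 0ℚ ≡ ι 0ℚ
  ⊗-zeroʳ x = ≡.trans (⊗-comm x (ι 0ℚ)) (⊗-zeroˡ x)

  ⊗-distribʳ-⊕ : ∀ x y z → (y ⊕ z) ⊗ x ≡ (y ⊗ x) ⊕ (z ⊗ x)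
  ⊗-distribʳ-⊕ x y z = ≡.trans (⊗-comm (y ⊕ z) x)
    (≡.trans (⊗-distribˡ-⊕ x y z) (≡.cong₂ _⊕_ (⊗-comm x y) (⊗-comm x z)))

  isCommutativeRing : IsCommutativeRing _≡_ _⊕_ _⊗_ ⊝_ (ι 0ℚ) (ι 1ℚ)
  isCommutativeRing = record
    { isRing = record
      { +-isAbelianGroup = record
        { isGroup = record
          { isMonoid = record
            { isSemigroup = record
              { isMagma = record { isEquivalence = ≡.isEquivalence ; ∙-cong = ≡.cong₂ _⊕_ }
              ; assoc = ⊕-assoc }
            ; identity = ⊕-identityˡ , ⊕-identityʳ }
          ; inverse = ⊝-inverseˡ , ⊝-inverseʳ
          ; ⁻¹-cong = ≡.cong ⊝_ }
        ; comm = ⊕-comm }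
      ; *-cong = ≡.cong₂ _⊗_
      ; *-assoc = ⊗-assoc
      ; *-identity = ⊗-identityˡ , ⊗-identityʳ
      ; distrib = ⊗-distribˡ-⊕ , ⊗-distribʳ-⊕ }
    ; *-comm = ⊗-comm }

  commutativeRing : CommutativeRing 0ℓ 0ℓ
  commutativeRing = record { isCommutativeRing = isCommutativeRing }

  _≟5_ : (x y : Q5) → Dec (x ≡ y)
  q5 a b ≟5 q5 c d with a ℚ.≟ c | b ℚ.≟ d
  ... | yes ≡.refl | yes ≡.refl = yes ≡.refl
  ... | no a≢c | _ = no (λ eq → a≢c (≡.cong re eq))
  ... | _ | no b≢d = no (λ eq → b≢d (≡.cong ir eq))

  module Q5-Solver = Algebra.Solver.Ring.Simple (fromCommutativeRing commutativeRing) _≟5_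

module Q5Sums where
  open Q5Ring
  open CommutativeRingSums commutativeRing public
    renaming (_^_ to _^₅_; _×_ to _×₅_; Σ< to Σ₅<; Σ-cong′ to Σ₅-cong′; Σ-distrib-+ to Σ₅-distrib-⊕;
              Σ-distrib-- to Σ₅-distrib-⊖; *-distribˡ-Σ to ⊗-distribˡ-Σ₅; *-distribʳ-Σ to ⊗-distribʳ-Σ₅;
              Σ-head to Σ₅-head; 1^n≈1 to 1^₅n≡1; binomial-theorem to binomial-theorem₅;
              ^-distrib-* to ^₅-distrib-⊗; ^-assocʳ to ^₅-assocʳ)
    using ()

  ι-* : ∀ a b → ι (a * b) ≡ ι a ⊗ ι b
  ι-* a b = ≡.cong₂ q5 (solve 2 (λ a b → a :* b := a :* b :+ con (nℚ 5) :* (con 0ℚ :* con 0ℚ)) ≡.refl a b)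
                       (solve 2 (λ a b → con 0ℚ := a :* con 0ℚ :+ con 0ℚ :* b) ≡.refl a b)
    where open +-*-Solver

  ι-Σ : ∀ n (f : ℕ → ℚ) → ι (Σ< n f) ≡ Σ₅< n (λ k → ι (f k))
  ι-Σ zero f = ≡.refl
  ι-Σ (suc n) f = ≡.cong (_⊕ ι (f n)) (ι-Σ n f)

  ι-^ : ∀ q k → ι (q ^ k) ≡ ι q ^₅ k
  ι-^ q zero = ≡.refl
  ι-^ q (suc k) = ≡.trans (ι-* q (q ^ k)) (≡.cong (ι q ⊗_) (ι-^ q k))

  ×₅≡ι⊗ : ∀ n x → n ×₅ x ≡ ι (nℚ n) ⊗ x
  ×₅≡ι⊗ zero x = solve 1 (λ x → con (ι 0ℚ) := con (ι 0ℚ) :* x) ≡.refl x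
    where open Q5-Solver
  ×₅≡ι⊗ (suc n) x = begin
    x ⊕ (n ×₅ x)                     ≡⟨ ≡.cong (x ⊕_) (×₅≡ι⊗ n x) ⟩
    x ⊕ (ι (nℚ n) ⊗ x)               ≡⟨ solve 2 (λ x c → x :+ c :* x := (con (ι 1ℚ) :+ c) :* x) ≡.refl x (ι (nℚ n)) ⟩
    (ι 1ℚ ⊕ ι (nℚ n)) ⊗ x            ≡⟨ ≡.cong (λ c → ι c ⊗ x) (nℚ-suc n) ⟨
    ι (nℚ (suc n)) ⊗ x               ∎
    where
    open Q5-Solver
    open ≡.≡-Reasoning

  ^5≡^₅ : ∀ x n → x ^5 n ≡ x ^₅ n
  ^5≡^₅ x zero = ≡.refl
  ^5≡^₅ x (suc n) = ≡.cong (x ⊗_) (^5≡^₅ x n)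

  binomial-theorem-1+x : ∀ N x → Σ₅< (suc N) (λ k → ι (nℚ (N C k)) ⊗ (x ^₅ k)) ≡ (ι 1ℚ ⊕ x) ^₅ N
  binomial-theorem-1+x N x = begin
    Σ₅< (suc N) (λ k → ι (nℚ (N C k)) ⊗ (x ^₅ k))
      ≡⟨ Σ₅-cong′ (suc N) (λ k → ≡.trans (×₅≡ι⊗ (N C k) _) (≡.cong (ι (nℚ (N C k)) ⊗_) (drop-1^ k))) ⟨
    Σ₅< (suc N) (λ k → (N C k) ×₅ ((x ^₅ k) ⊗ (ι 1ℚ ^₅ (N ∸ k))))
      ≡⟨ binomial-theorem₅ N x (ι 1ℚ) ⟩
    (x ⊕ ι 1ℚ) ^₅ N
      ≡⟨ ≡.cong (_^₅ N) (⊕-comm x (ι 1ℚ)) ⟩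
    (ι 1ℚ ⊕ x) ^₅ N ∎
    where
    open ≡.≡-Reasoning
    drop-1^ : ∀ k → (x ^₅ k) ⊗ (ι 1ℚ ^₅ (N ∸ k)) ≡ x ^₅ k
    drop-1^ k = ≡.trans (≡.cong ((x ^₅ k) ⊗_) (1^₅n≡1 (N ∸ k))) (⊗-identityʳ (x ^₅ k))

  Σ₅-ι-split : ∀ n (c a d : ℕ → ℚ) R →
    Σ₅< n (λ k → ι (c k) ⊗ ((ι (a k) ⊗ R) ⊖ ι (d k)))
      ≡ (ι (Σ< n (λ k → c k * a k)) ⊗ R) ⊖ ι (Σ< n (λ k → c k * d k))
  Σ₅-ι-split n c a d R = begin
    Σ₅< n (λ k → ι (c k) ⊗ ((ι (a k) ⊗ R) ⊖ ι (d k)))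
      ≡⟨ Σ₅-cong′ n term ⟩
    Σ₅< n (λ k → (ι (c k * a k) ⊗ R) ⊖ ι (c k * d k))
      ≡⟨ Σ₅-distrib-⊖ n (λ k → ι (c k * a k) ⊗ R) (λ k → ι (c k * d k)) ⟩
    Σ₅< n (λ k → ι (c k * a k) ⊗ R) ⊖ Σ₅< n (λ k → ι (c k * d k))
      ≡⟨ ≡.cong₂ _⊖_ (⊗-distribʳ-Σ₅ n R (λ k → ι (c k * a k))) (ι-Σ n (λ k → c k * d k)) ⟨
    (Σ₅< n (λ k → ι (c k * a k)) ⊗ R) ⊖ ι (Σ< n (λ k → c k * d k))
      ≡⟨ ≡.cong (λ x → (x ⊗ R) ⊖ ι (Σ< n (λ k → c k * d k))) (ι-Σ n (λ k → c k * a k)) ⟨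
    (ι (Σ< n (λ k → c k * a k)) ⊗ R) ⊖ ι (Σ< n (λ k → c k * d k)) ∎
    where
    open ≡.≡-Reasoning
    term : ∀ k → ι (c k) ⊗ ((ι (a k) ⊗ R) ⊖ ι (d k)) ≡ (ι (c k * a k) ⊗ R) ⊖ ι (c k * d k)
    term k = ≡.trans
      (solve 4 (λ c a d r → c :* ((a :* r) :- d) := ((c :* a) :* r) :- (c :* d)) ≡.refl (ι (c k)) (ι (a k)) (ι (d k)) R)
      (≡.sym (≡.cong₂ (λ x y → (x ⊗ R) ⊖ y) (ι-* (c k) (a k)) (ι-* (c k) (d k))))
      where open Q5-Solver

  √5-cancelˡ : ∀ {x y} → √5 ⊗ x ≡ √5 ⊗ y → x ≡ y
  √5-cancelˡ {x} {y} eq = begin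
    x                        ≡⟨ ⊗-identityˡ x ⟨
    ι 1ℚ ⊗ x                 ≡⟨ ≡.cong (_⊗ x) 1/√5⊗√5≡1 ⟨
    (1/√5 ⊗ √5) ⊗ x          ≡⟨ ⊗-assoc 1/√5 √5 x ⟩
    1/√5 ⊗ (√5 ⊗ x)          ≡⟨ ≡.cong (1/√5 ⊗_) eq ⟩
    1/√5 ⊗ (√5 ⊗ y)          ≡⟨ ⊗-assoc 1/√5 √5 y ⟨
    (1/√5 ⊗ √5) ⊗ y          ≡⟨ ≡.cong (_⊗ y) 1/√5⊗√5≡1 ⟩
    ι 1ℚ ⊗ y                 ≡⟨ ⊗-identityˡ y ⟩
    y                        ∎
    where
    open ≡.≡-Reasoning
    1/√5 : Q5
    1/√5 = q5 0ℚ (inv (nℚ 5))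
    1/√5⊗√5≡1 : 1/√5 ⊗ √5 ≡ ι 1ℚ
    1/√5⊗√5≡1 = ≡.refl

  private
    Σ5-from : (ℕ → Q5) → ℕ → ℕ → Q5
    Σ5-from f a zero = ι 0ℚ
    Σ5-from f a (suc len) = f a ⊕ Σ5-from f (suc a) len

    1+b∸a≡1+l⇒b∸a≡l : ∀ a b {l} → suc b ∸ a ≡ suc l → b ∸ a ≡ l
    1+b∸a≡1+l⇒b∸a≡l zero b eq = ℕ.suc-injective eq
    1+b∸a≡1+l⇒b∸a≡l (suc a) zero eq with () ← ≡.trans (≡.sym (ℕ.0∸n≡0 a)) eq
    1+b∸a≡1+l⇒b∸a≡l (suc a) (suc b) eq = 1+b∸a≡1+l⇒b∸a≡l a b eq

    -- Σ5[_,_] recurses through a local function of Defs; we follow it by abstracting its length suc b ∸ a.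
    Σ5-unfold : ∀ f a b {len} → suc b ∸ a ≡ len → Σ5[ a , b ] f ≡ Σ5-from f a len
    Σ5-unfold f a b eq with suc b ∸ a in e
    Σ5-unfold f a b ≡.refl | zero = ≡.refl
    Σ5-unfold f a b ≡.refl | suc l with b ∸ a | Σ5-unfold f (suc a) b (1+b∸a≡1+l⇒b∸a≡l a b e) | 1+b∸a≡1+l⇒b∸a≡l a b e
    ... | _ | rest | ≡.refl = ≡.cong (f a ⊕_) rest

    Σ5-from≡Σ₅ : ∀ f a len → Σ5-from f a len ≡ Σ₅< len (λ k → f (a ℕ.+ k))
    Σ5-from≡Σ₅ f a zero = ≡.refl
    Σ5-from≡Σ₅ f a (suc len) = begin
      f a ⊕ Σ5-from f (suc a) len                          ≡⟨ ≡.cong (f a ⊕_) (Σ5-from≡Σ₅ f (suc a) len) ⟩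
      f a ⊕ Σ₅< len (λ k → f (suc a ℕ.+ k))
        ≡⟨ ≡.cong₂ _⊕_ (≡.cong f (ℕ.+-identityʳ a)) (Σ₅-cong′ len (λ k → ≡.cong f (ℕ.+-suc a k))) ⟨
      f (a ℕ.+ 0) ⊕ Σ₅< len (λ k → f (a ℕ.+ suc k))        ≡⟨ Σ₅-head len (λ k → f (a ℕ.+ k)) ⟨
      Σ₅< (suc len) (λ k → f (a ℕ.+ k))                    ∎
      where open ≡.≡-Reasoning

  Σ5[0,n]≡Σ₅< : ∀ n f → Σ5[ 0 , n ] f ≡ Σ₅< (suc n) f
  Σ5[0,n]≡Σ₅< n f = ≡.trans (Σ5-unfold f 0 n ≡.refl) (Σ5-from≡Σ₅ f 0 (suc n))

module Binet where
  open Q5Ring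
  open Q5Sums
  open Q5-Solver
  open ≡.≡-Reasoning

  φ ψ : Q5
  φ = q5 (inv (nℚ 2)) (inv (nℚ 2))
  ψ = q5 (inv (nℚ 2)) (- inv (nℚ 2))

  golden-power : ∀ x → x ⊗ x ≡ x ⊕ ι 1ℚ → ∀ m → x ^₅ suc (suc m) ≡ (x ^₅ suc m) ⊕ (x ^₅ m)
  golden-power x x²≡x+1 m = begin
    x ⊗ (x ⊗ (x ^₅ m))                  ≡⟨ ⊗-assoc x x (x ^₅ m) ⟨
    (x ⊗ x) ⊗ (x ^₅ m)                  ≡⟨ ≡.cong (_⊗ (x ^₅ m)) x²≡x+1 ⟩
    (x ⊕ ι 1ℚ) ⊗ (x ^₅ m)               ≡⟨ solve 2 (λ x p → (x :+ con (ι 1ℚ)) :* p := x :* p :+ p) ≡.refl x (x ^₅ m) ⟩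
    (x ⊗ (x ^₅ m)) ⊕ (x ^₅ m)           ∎

  binet-fib : ∀ m → √5 ⊗ ι (nℚ (fib m)) ≡ (φ ^₅ m) ⊖ (ψ ^₅ m)
  binet-fib zero = ≡.refl
  binet-fib (suc zero) = ≡.refl
  binet-fib (suc (suc m)) = begin
    √5 ⊗ ι (nℚ (fib (suc m) ℕ.+ fib m))
      ≡⟨ ≡.cong (λ x → √5 ⊗ ι x) (nℚ-+ (fib (suc m)) (fib m)) ⟩
    √5 ⊗ (ι (nℚ (fib (suc m))) ⊕ ι (nℚ (fib m)))
      ≡⟨ ⊗-distribˡ-⊕ √5 (ι (nℚ (fib (suc m)))) (ι (nℚ (fib m))) ⟩
    (√5 ⊗ ι (nℚ (fib (suc m)))) ⊕ (√5 ⊗ ι (nℚ (fib m)))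
      ≡⟨ ≡.cong₂ _⊕_ (binet-fib (suc m)) (binet-fib m) ⟩
    ((φ ^₅ suc m) ⊖ (ψ ^₅ suc m)) ⊕ ((φ ^₅ m) ⊖ (ψ ^₅ m))
      ≡⟨ solve 4 (λ a b c d → (a :- b) :+ (c :- d) := (a :+ c) :- (b :+ d)) ≡.refl (φ ^₅ suc m) (ψ ^₅ suc m) (φ ^₅ m) (ψ ^₅ m) ⟩
    ((φ ^₅ suc m) ⊕ (φ ^₅ m)) ⊖ ((ψ ^₅ suc m) ⊕ (ψ ^₅ m))
      ≡⟨ ≡.cong₂ _⊖_ (golden-power φ ≡.refl m) (golden-power ψ ≡.refl m) ⟨
    (φ ^₅ suc (suc m)) ⊖ (ψ ^₅ suc (suc m)) ∎

  binet-luc : ∀ m → ι (nℚ (luc m)) ≡ (φ ^₅ m) ⊕ (ψ ^₅ m)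
  binet-luc zero = ≡.refl
  binet-luc (suc zero) = ≡.refl
  binet-luc (suc (suc m)) = begin
    ι (nℚ (luc (suc m) ℕ.+ luc m))
      ≡⟨ ≡.cong ι (nℚ-+ (luc (suc m)) (luc m)) ⟩
    ι (nℚ (luc (suc m))) ⊕ ι (nℚ (luc m))
      ≡⟨ ≡.cong₂ _⊕_ (binet-luc (suc m)) (binet-luc m) ⟩
    ((φ ^₅ suc m) ⊕ (ψ ^₅ suc m)) ⊕ ((φ ^₅ m) ⊕ (ψ ^₅ m))
      ≡⟨ solve 4 (λ a b c d → (a :+ b) :+ (c :+ d) := (a :+ c) :+ (b :+ d)) ≡.refl (φ ^₅ suc m) (ψ ^₅ suc m) (φ ^₅ m) (ψ ^₅ m) ⟩
    ((φ ^₅ suc m) ⊕ (φ ^₅ m)) ⊕ ((ψ ^₅ suc m) ⊕ (ψ ^₅ m))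
      ≡⟨ ≡.cong₂ _⊕_ (golden-power φ ≡.refl m) (golden-power ψ ≡.refl m) ⟨
    (φ ^₅ suc (suc m)) ⊕ (ψ ^₅ suc (suc m)) ∎

inv5-inverseʳ : ∀ x → re x * re x - nℚ 5 * (ir x * ir x) ≢ 0ℚ → x ⊗ inv5 x ≡ ι 1ℚ
inv5-inverseʳ (q5 a b) norm≢0 = ≡.cong₂ q5
  (≡.trans (solve 3 (λ a b n → a :* (a :* n) :+ con (nℚ 5) :* (b :* ((:- b) :* n)) := (a :* a :- con (nℚ 5) :* (b :* b)) :* n) ≡.refl a b N)
           (inv-inverseʳ norm≢0))
  (solve 3 (λ a b n → a :* ((:- b) :* n) :+ b :* (a :* n) := con 0ℚ) ≡.refl a b N)
  where
  open +-*-Solver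
  N : ℚ
  N = inv (a * a - nℚ 5 * (b * b))

-- Binomial sums of Fibonacci and Lucas numbers

luc≥1 : ∀ n → 1 ≤ luc n
luc≥1 zero = s≤s z≤n
luc≥1 (suc zero) = s≤s z≤n
luc≥1 (suc (suc n)) = ℕ.≤-trans (luc≥1 (suc n)) (ℕ.m≤m+n (luc (suc n)) (luc n))

fib≥1 : ∀ {n} → 1 ≤ n → 1 ≤ fib n
fib≥1 {suc zero} _ = s≤s z≤n
fib≥1 {suc (suc n)} _ = ℕ.≤-trans (fib≥1 {suc n} (s≤s z≤n)) (ℕ.m≤m+n (fib (suc n)) (fib n))

module FibonacciLucasBinomialSums (j : ℕ) (1≤j : 1 ≤ j) where
  open Q5Ring
  open Q5Sums
  open Binet
  open ≡.≡-Reasoning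

  L F t : ℚ
  L = nℚ (luc j)
  F = nℚ (fib j)
  t = - nℚ 2 * inv L

  u v : Q5
  u = ι (inv L) ⊗ (√5 ⊗ ι F)
  v = ι L ⊗ inv5 (√5 ⊗ ι F)

  L≢0 : L ≢ 0ℚ
  L≢0 = nℚ≢0 (luc≥1 j)

  F≢0 : F ≢ 0ℚ
  F≢0 = nℚ≢0 (fib≥1 1≤j)

  t≢0 : t ≢ 0ℚ
  t≢0 = *-≢0 {x = - nℚ 2} (λ ()) (inv-≢0 L≢0)

  sgn*2^/L^≡t^ : ∀ k → sgn k * nℚ (2 ℕ.^ k) * inv (nℚ (luc j ℕ.^ k)) ≡ t ^ k
  sgn*2^/L^≡t^ k = begin
    sgn k * nℚ (2 ℕ.^ k) * inv (nℚ (luc j ℕ.^ k))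
      ≡⟨ ≡.cong₂ (λ s p → s * p * inv (nℚ (luc j ℕ.^ k))) (^ℚ≡^ (- 1ℚ) k) (nℚ-^ 2 k) ⟩
    (- 1ℚ) ^ k * nℚ 2 ^ k * inv (nℚ (luc j ℕ.^ k))
      ≡⟨ ≡.cong₂ (λ p i → p * i) (^-distrib-* (- 1ℚ) (nℚ 2) k) (≡.sym (≡.trans (≡.cong inv (nℚ-^ (luc j) k)) (inv-^ L≢0 k))) ⟨
    (- nℚ 2) ^ k * inv L ^ k
      ≡⟨ ^-distrib-* (- nℚ 2) (inv L) k ⟨
    t ^ k ∎

  ι1≡ιL⊗ι[1/L] : ι 1ℚ ≡ ι L ⊗ ι (inv L)
  ι1≡ιL⊗ι[1/L] = ≡.trans (≡.cong ι (≡.sym (inv-inverseʳ L≢0))) (ι-* L (inv L))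

  ι1⊕tφʲ≡⊝u : ι 1ℚ ⊕ (ι t ⊗ (φ ^₅ j)) ≡ ⊝ u
  ι1⊕tφʲ≡⊝u = begin
    ι 1ℚ ⊕ (ι t ⊗ (φ ^₅ j))
      ≡⟨ ≡.cong₂ (λ a b → a ⊕ (b ⊗ (φ ^₅ j))) (ι1≡ιL⊗ι[1/L]) (ι-* (- nℚ 2) (inv L)) ⟩
    (ι L ⊗ ι (inv L)) ⊕ ((ι (- nℚ 2) ⊗ ι (inv L)) ⊗ (φ ^₅ j))
      ≡⟨ ≡.cong (λ l → (l ⊗ ι (inv L)) ⊕ ((ι (- nℚ 2) ⊗ ι (inv L)) ⊗ (φ ^₅ j))) (binet-luc j) ⟩
    (((φ ^₅ j) ⊕ (ψ ^₅ j)) ⊗ ι (inv L)) ⊕ ((ι (- nℚ 2) ⊗ ι (inv L)) ⊗ (φ ^₅ j))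
      ≡⟨ solve 3 (λ a b i → ((a :+ b) :* i) :+ ((con (ι (- nℚ 2)) :* i) :* a) := :- (i :* (a :- b))) ≡.refl (φ ^₅ j) (ψ ^₅ j) (ι (inv L)) ⟩
    ⊝ (ι (inv L) ⊗ ((φ ^₅ j) ⊖ (ψ ^₅ j)))
      ≡⟨ ≡.cong (λ s → ⊝ (ι (inv L) ⊗ s)) (binet-fib j) ⟨
    ⊝ u ∎
    where open Q5-Solver

  ι1⊕tψʲ≡u : ι 1ℚ ⊕ (ι t ⊗ (ψ ^₅ j)) ≡ u
  ι1⊕tψʲ≡u = begin
    ι 1ℚ ⊕ (ι t ⊗ (ψ ^₅ j))
      ≡⟨ ≡.cong₂ (λ a b → a ⊕ (b ⊗ (ψ ^₅ j))) ι1≡ιL⊗ι[1/L] (ι-* (- nℚ 2) (inv L)) ⟩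
    (ι L ⊗ ι (inv L)) ⊕ ((ι (- nℚ 2) ⊗ ι (inv L)) ⊗ (ψ ^₅ j))
      ≡⟨ ≡.cong (λ l → (l ⊗ ι (inv L)) ⊕ ((ι (- nℚ 2) ⊗ ι (inv L)) ⊗ (ψ ^₅ j))) (binet-luc j) ⟩
    (((φ ^₅ j) ⊕ (ψ ^₅ j)) ⊗ ι (inv L)) ⊕ ((ι (- nℚ 2) ⊗ ι (inv L)) ⊗ (ψ ^₅ j))
      ≡⟨ solve 3 (λ a b i → ((a :+ b) :* i) :+ ((con (ι (- nℚ 2)) :* i) :* b) := i :* (a :- b)) ≡.refl (φ ^₅ j) (ψ ^₅ j) (ι (inv L)) ⟩
    ι (inv L) ⊗ ((φ ^₅ j) ⊖ (ψ ^₅ j))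
      ≡⟨ ≡.cong (ι (inv L) ⊗_) (binet-fib j) ⟨
    u ∎
    where open Q5-Solver

  binomial-t·xʲ : ∀ x w → ι 1ℚ ⊕ (ι t ⊗ (x ^₅ j)) ≡ w →
    ∀ N → Σ₅< (suc N) (λ k → ι (nℚ (N C k) * t ^ k) ⊗ (x ^₅ (j ℕ.* k))) ≡ w ^₅ N
  binomial-t·xʲ x w 1+txʲ≡w N = begin
    Σ₅< (suc N) (λ k → ι (nℚ (N C k) * t ^ k) ⊗ (x ^₅ (j ℕ.* k)))
      ≡⟨ Σ₅-cong′ (suc N) term ⟩
    Σ₅< (suc N) (λ k → ι (nℚ (N C k)) ⊗ ((ι t ⊗ (x ^₅ j)) ^₅ k))
      ≡⟨ binomial-theorem-1+x N (ι t ⊗ (x ^₅ j)) ⟩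
    (ι 1ℚ ⊕ (ι t ⊗ (x ^₅ j))) ^₅ N
      ≡⟨ ≡.cong (_^₅ N) 1+txʲ≡w ⟩
    w ^₅ N ∎
    where
    term : ∀ k → ι (nℚ (N C k) * t ^ k) ⊗ (x ^₅ (j ℕ.* k)) ≡ ι (nℚ (N C k)) ⊗ ((ι t ⊗ (x ^₅ j)) ^₅ k)
    term k = begin
      ι (nℚ (N C k) * t ^ k) ⊗ (x ^₅ (j ℕ.* k))
        ≡⟨ ≡.cong₂ _⊗_ (≡.trans (ι-* (nℚ (N C k)) (t ^ k)) (≡.cong (ι (nℚ (N C k)) ⊗_) (ι-^ t k))) (≡.sym (^₅-assocʳ x j k)) ⟩
      (ι (nℚ (N C k)) ⊗ (ι t ^₅ k)) ⊗ ((x ^₅ j) ^₅ k)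
        ≡⟨ ⊗-assoc (ι (nℚ (N C k))) (ι t ^₅ k) ((x ^₅ j) ^₅ k) ⟩
      ι (nℚ (N C k)) ⊗ ((ι t ^₅ k) ⊗ ((x ^₅ j) ^₅ k))
        ≡⟨ ≡.cong (ι (nℚ (N C k)) ⊗_) (^₅-distrib-⊗ (ι t) (x ^₅ j) k) ⟨
      ι (nℚ (N C k)) ⊗ ((ι t ⊗ (x ^₅ j)) ^₅ k) ∎

  ⊝u^N : ∀ N → (⊝ u) ^₅ N ≡ ι ((- 1ℚ) ^ N) ⊗ (u ^₅ N)
  ⊝u^N N = begin
    (⊝ u) ^₅ N                       ≡⟨ ≡.cong (_^₅ N) (solve 1 (λ u → :- u := con (ι (- 1ℚ)) :* u) ≡.refl u) ⟩
    (ι (- 1ℚ) ⊗ u) ^₅ N              ≡⟨ ^₅-distrib-⊗ (ι (- 1ℚ)) u N ⟩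
    (ι (- 1ℚ) ^₅ N) ⊗ (u ^₅ N)       ≡⟨ ≡.cong (_⊗ (u ^₅ N)) (ι-^ (- 1ℚ) N) ⟨
    ι ((- 1ℚ) ^ N) ⊗ (u ^₅ N)        ∎
    where open Q5-Solver

  lucas-binomial-sum : ∀ N →
    ι (Σ< (suc N) (λ k → nℚ (N C k) * (t ^ k * nℚ (luc (j ℕ.* k))))) ≡ (ι ((- 1ℚ) ^ N) ⊕ ι 1ℚ) ⊗ (u ^₅ N)
  lucas-binomial-sum N = begin
    ι (Σ< (suc N) (λ k → nℚ (N C k) * (t ^ k * nℚ (luc (j ℕ.* k)))))
      ≡⟨ ≡.cong ι (Σ-cong′ (suc N) (λ k → ℚ.*-assoc (nℚ (N C k)) (t ^ k) _)) ⟨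
    ι (Σ< (suc N) (λ k → c k * nℚ (luc (j ℕ.* k))))
      ≡⟨ ι-Σ (suc N) (λ k → c k * nℚ (luc (j ℕ.* k))) ⟩
    Σ₅< (suc N) (λ k → ι (c k * nℚ (luc (j ℕ.* k))))
      ≡⟨ Σ₅-cong′ (suc N) split ⟩
    Σ₅< (suc N) (λ k → (ι (c k) ⊗ (φ ^₅ (j ℕ.* k))) ⊕ (ι (c k) ⊗ (ψ ^₅ (j ℕ.* k))))
      ≡⟨ Σ₅-distrib-⊕ (suc N) (λ k → ι (c k) ⊗ (φ ^₅ (j ℕ.* k))) (λ k → ι (c k) ⊗ (ψ ^₅ (j ℕ.* k))) ⟩
    Σ₅< (suc N) (λ k → ι (c k) ⊗ (φ ^₅ (j ℕ.* k))) ⊕ Σ₅< (suc N) (λ k → ι (c k) ⊗ (ψ ^₅ (j ℕ.* k)))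
      ≡⟨ ≡.cong₂ _⊕_ (binomial-t·xʲ φ (⊝ u) ι1⊕tφʲ≡⊝u N) (binomial-t·xʲ ψ u ι1⊕tψʲ≡u N) ⟩
    ((⊝ u) ^₅ N) ⊕ (u ^₅ N)
      ≡⟨ ≡.cong (_⊕ (u ^₅ N)) (⊝u^N N) ⟩
    (ι ((- 1ℚ) ^ N) ⊗ (u ^₅ N)) ⊕ (u ^₅ N)
      ≡⟨ solve 2 (λ s w → (s :* w) :+ w := (s :+ con (ι 1ℚ)) :* w) ≡.refl (ι ((- 1ℚ) ^ N)) (u ^₅ N) ⟩
    (ι ((- 1ℚ) ^ N) ⊕ ι 1ℚ) ⊗ (u ^₅ N) ∎
    where
    open Q5-Solver
    c : ℕ → ℚ
    c k = nℚ (N C k) * t ^ k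
    split : ∀ k → ι (c k * nℚ (luc (j ℕ.* k))) ≡ (ι (c k) ⊗ (φ ^₅ (j ℕ.* k))) ⊕ (ι (c k) ⊗ (ψ ^₅ (j ℕ.* k)))
    split k = ≡.trans (ι-* (c k) (nℚ (luc (j ℕ.* k))))
      (≡.trans (≡.cong (ι (c k) ⊗_) (binet-luc (j ℕ.* k))) (⊗-distribˡ-⊕ (ι (c k)) _ _))

  fibonacci-binomial-sum : ∀ N →
    √5 ⊗ ι (Σ< (suc N) (λ k → nℚ (N C k) * (t ^ k * nℚ (fib (j ℕ.* k))))) ≡ (ι ((- 1ℚ) ^ N) ⊖ ι 1ℚ) ⊗ (u ^₅ N)
  fibonacci-binomial-sum N = begin
    √5 ⊗ ι (Σ< (suc N) (λ k → nℚ (N C k) * (t ^ k * nℚ (fib (j ℕ.* k)))))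
      ≡⟨ ≡.cong (λ x → √5 ⊗ ι x) (Σ-cong′ (suc N) (λ k → ℚ.*-assoc (nℚ (N C k)) (t ^ k) _)) ⟨
    √5 ⊗ ι (Σ< (suc N) (λ k → c k * nℚ (fib (j ℕ.* k))))
      ≡⟨ ≡.cong (√5 ⊗_) (ι-Σ (suc N) (λ k → c k * nℚ (fib (j ℕ.* k)))) ⟩
    √5 ⊗ Σ₅< (suc N) (λ k → ι (c k * nℚ (fib (j ℕ.* k))))
      ≡⟨ ⊗-distribˡ-Σ₅ (suc N) √5 (λ k → ι (c k * nℚ (fib (j ℕ.* k)))) ⟩
    Σ₅< (suc N) (λ k → √5 ⊗ ι (c k * nℚ (fib (j ℕ.* k))))
      ≡⟨ Σ₅-cong′ (suc N) split ⟩
    Σ₅< (suc N) (λ k → (ι (c k) ⊗ (φ ^₅ (j ℕ.* k))) ⊖ (ι (c k) ⊗ (ψ ^₅ (j ℕ.* k))))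
      ≡⟨ Σ₅-distrib-⊖ (suc N) (λ k → ι (c k) ⊗ (φ ^₅ (j ℕ.* k))) (λ k → ι (c k) ⊗ (ψ ^₅ (j ℕ.* k))) ⟩
    Σ₅< (suc N) (λ k → ι (c k) ⊗ (φ ^₅ (j ℕ.* k))) ⊖ Σ₅< (suc N) (λ k → ι (c k) ⊗ (ψ ^₅ (j ℕ.* k)))
      ≡⟨ ≡.cong₂ _⊖_ (binomial-t·xʲ φ (⊝ u) ι1⊕tφʲ≡⊝u N) (binomial-t·xʲ ψ u ι1⊕tψʲ≡u N) ⟩
    ((⊝ u) ^₅ N) ⊖ (u ^₅ N)
      ≡⟨ ≡.cong (_⊖ (u ^₅ N)) (⊝u^N N) ⟩
    (ι ((- 1ℚ) ^ N) ⊗ (u ^₅ N)) ⊖ (u ^₅ N)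
      ≡⟨ solve 2 (λ s w → (s :* w) :- w := (s :- con (ι 1ℚ)) :* w) ≡.refl (ι ((- 1ℚ) ^ N)) (u ^₅ N) ⟩
    (ι ((- 1ℚ) ^ N) ⊖ ι 1ℚ) ⊗ (u ^₅ N) ∎
    where
    open Q5-Solver
    c : ℕ → ℚ
    c k = nℚ (N C k) * t ^ k
    split : ∀ k → √5 ⊗ ι (c k * nℚ (fib (j ℕ.* k))) ≡ (ι (c k) ⊗ (φ ^₅ (j ℕ.* k))) ⊖ (ι (c k) ⊗ (ψ ^₅ (j ℕ.* k)))
    split k = begin
      √5 ⊗ ι (c k * nℚ (fib (j ℕ.* k)))                ≡⟨ ≡.cong (√5 ⊗_) (ι-* (c k) (nℚ (fib (j ℕ.* k)))) ⟩
      √5 ⊗ (ι (c k) ⊗ ι (nℚ (fib (j ℕ.* k))))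
        ≡⟨ solve 3 (λ r c f → r :* (c :* f) := c :* (r :* f)) ≡.refl √5 (ι (c k)) (ι (nℚ (fib (j ℕ.* k)))) ⟩
      ι (c k) ⊗ (√5 ⊗ ι (nℚ (fib (j ℕ.* k))))          ≡⟨ ≡.cong (ι (c k) ⊗_) (binet-fib (j ℕ.* k)) ⟩
      ι (c k) ⊗ ((φ ^₅ (j ℕ.* k)) ⊖ (ψ ^₅ (j ℕ.* k)))
        ≡⟨ solve 3 (λ c a b → c :* (a :- b) := c :* a :- c :* b) ≡.refl (ι (c k)) (φ ^₅ (j ℕ.* k)) (ψ ^₅ (j ℕ.* k)) ⟩
      (ι (c k) ⊗ (φ ^₅ (j ℕ.* k))) ⊖ (ι (c k) ⊗ (ψ ^₅ (j ℕ.* k))) ∎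

  norm[√5F]≢0 : re (√5 ⊗ ι F) * re (√5 ⊗ ι F) - nℚ 5 * (ir (√5 ⊗ ι F) * ir (√5 ⊗ ι F)) ≢ 0ℚ
  norm[√5F]≢0 eq = F≢0 (*≡0⇒≡0 F≢0 (*≡0⇒≡0 {c = - nℚ 5} (λ ()) (≡.trans norm eq)))
    where
    open +-*-Solver
    re≡0 : re (√5 ⊗ ι F) ≡ 0ℚ
    re≡0 = solve 1 (λ f → con 0ℚ :* f :+ con (nℚ 5) :* (con 1ℚ :* con 0ℚ) := con 0ℚ) ≡.refl F
    ir≡F : ir (√5 ⊗ ι F) ≡ F
    ir≡F = solve 1 (λ f → con 0ℚ :* con 0ℚ :+ con 1ℚ :* f := f) ≡.refl F
    norm : F * F * - nℚ 5 ≡ re (√5 ⊗ ι F) * re (√5 ⊗ ι F) - nℚ 5 * (ir (√5 ⊗ ι F) * ir (√5 ⊗ ι F))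
    norm = ≡.trans (solve 1 (λ f → f :* f :* con (- nℚ 5) := con 0ℚ :* con 0ℚ :- con (nℚ 5) :* (f :* f)) ≡.refl F)
      (≡.cong₂ (λ a b → a * a - nℚ 5 * (b * b)) (≡.sym re≡0) (≡.sym ir≡F))

  u⊗v≡1 : u ⊗ v ≡ ι 1ℚ
  u⊗v≡1 = begin
    (ι (inv L) ⊗ s) ⊗ (ι L ⊗ inv5 s)
      ≡⟨ solve 4 (λ i s l r → (i :* s) :* (l :* r) := (i :* l) :* (s :* r)) ≡.refl (ι (inv L)) s (ι L) (inv5 s) ⟩
    (ι (inv L) ⊗ ι L) ⊗ (s ⊗ inv5 s)
      ≡⟨ ≡.cong₂ _⊗_ (≡.trans (≡.sym (ι-* (inv L) L)) (≡.cong ι (inv-inverseˡ L≢0))) (inv5-inverseʳ s norm[√5F]≢0) ⟩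
    ι 1ℚ ⊗ ι 1ℚ                            ≡⟨ ≡.refl ⟩
    ι 1ℚ                                   ∎
    where
    open Q5-Solver
    s : Q5
    s = √5 ⊗ ι F

  u^n⊗v^5n≡1 : ∀ n → (u ^₅ n) ⊗ (v ^5 n) ≡ ι 1ℚ
  u^n⊗v^5n≡1 n = begin
    (u ^₅ n) ⊗ (v ^5 n)     ≡⟨ ≡.cong ((u ^₅ n) ⊗_) (^5≡^₅ v n) ⟩
    (u ^₅ n) ⊗ (v ^₅ n)     ≡⟨ ^₅-distrib-⊗ u v n ⟨
    (u ⊗ v) ^₅ n            ≡⟨ ≡.cong (_^₅ n) u⊗v≡1 ⟩
    ι 1ℚ ^₅ n               ≡⟨ 1^₅n≡1 n ⟩
    ι 1ℚ                    ∎

  fibonacci-binomial-sum-rational : ∀ N →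
    ι (Σ< (suc (suc N)) (λ k → nℚ (suc N C k) * (t ^ k * nℚ (fib (j ℕ.* k)))))
      ≡ ι (((- 1ℚ) ^ suc N - 1ℚ) * (inv L * F)) ⊗ (u ^₅ N)
  fibonacci-binomial-sum-rational N = √5-cancelˡ (begin
    √5 ⊗ ι (Σ< (suc (suc N)) (λ k → nℚ (suc N C k) * (t ^ k * nℚ (fib (j ℕ.* k)))))
      ≡⟨ fibonacci-binomial-sum (suc N) ⟩
    (ι s ⊖ ι 1ℚ) ⊗ ((ι (inv L) ⊗ (√5 ⊗ ι F)) ⊗ (u ^₅ N))
      ≡⟨ solve 5 (λ s i r f w → (s :- con (ι 1ℚ)) :* ((i :* (r :* f)) :* w) := r :* (((s :- con (ι 1ℚ)) :* (i :* f)) :* w)) ≡.refl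
           (ι s) (ι (inv L)) √5 (ι F) (u ^₅ N) ⟩
    √5 ⊗ (((ι s ⊖ ι 1ℚ) ⊗ (ι (inv L) ⊗ ι F)) ⊗ (u ^₅ N))
      ≡⟨ ≡.cong (λ x → √5 ⊗ (x ⊗ (u ^₅ N))) (≡.trans (ι-* (s - 1ℚ) (inv L * F)) (≡.cong ((ι s ⊖ ι 1ℚ) ⊗_) (ι-* (inv L) F))) ⟨
    √5 ⊗ (ι ((s - 1ℚ) * (inv L * F)) ⊗ (u ^₅ N)) ∎)
    where
    open Q5-Solver
    s : ℚ
    s = (- 1ℚ) ^ suc N

  inv-t*inv-L : inv t * inv L ≡ - inv (nℚ 2)
  inv-t*inv-L = begin
    inv t * inv L              ≡⟨ inv-distrib-* t≢0 L≢0 ⟨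
    inv (- nℚ 2 * inv L * L)   ≡⟨ ≡.cong inv (≡.trans (ℚ.*-assoc (- nℚ 2) (inv L) L) (≡.cong (- nℚ 2 *_) (inv-inverseˡ L≢0))) ⟩
    inv (- nℚ 2 * 1ℚ)          ≡⟨⟩
    - inv (nℚ 2)               ∎


module FibonacciLucasBernoulliIdentities (j : ℕ) (1≤j : 1 ≤ j) where
  open Q5Ring using (⊗-assoc; ⊗-identityʳ; ⊗-zeroˡ; ⊗-zeroʳ; ⊕-comm)
  open Q5Sums
  open FibonacciLucasBinomialSums j 1≤j
  open BernoulliSeries using (bernoulli-sum-over-[n∸k+1]; bernoulli-sum-over-[k+1][k+2])
  open +-*-Solver
  open ≡.≡-Reasoning

  lucas-summand : ∀ N k → sgn k * nℚ (N C k) * (nℚ (2 ℕ.^ k) * nℚ (luc (j ℕ.* k)) * inv (nℚ (luc j ℕ.^ k)))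
                          ≡ nℚ (N C k) * (t ^ k * nℚ (luc (j ℕ.* k)))
  lucas-summand N k = begin
    sgn k * nℚ (N C k) * (nℚ (2 ℕ.^ k) * nℚ (luc (j ℕ.* k)) * inv (nℚ (luc j ℕ.^ k)))
      ≡⟨ solve 5 (λ s c p l i → s :* c :* (p :* l :* i) := c :* (s :* p :* i :* l)) ≡.refl
           (sgn k) (nℚ (N C k)) (nℚ (2 ℕ.^ k)) (nℚ (luc (j ℕ.* k))) (inv (nℚ (luc j ℕ.^ k))) ⟩
    nℚ (N C k) * (sgn k * nℚ (2 ℕ.^ k) * inv (nℚ (luc j ℕ.^ k)) * nℚ (luc (j ℕ.* k)))
      ≡⟨ ≡.cong (λ x → nℚ (N C k) * (x * nℚ (luc (j ℕ.* k)))) (sgn*2^/L^≡t^ k) ⟩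
    nℚ (N C k) * (t ^ k * nℚ (luc (j ℕ.* k))) ∎

  lucas-identity : ∀ {m} p → m ≡ suc (suc (p ℕ.+ p)) →
    Σℚ[ 0 , m ∸ 1 ] (λ k → sgn k * nℚ ((m ∸ 1) C k)
      * (nℚ (2 ℕ.^ k) * nℚ (luc (j ℕ.* k)) * inv (nℚ (luc j ℕ.^ k))))
    ≡ 0ℚ
  lucas-identity p ≡.refl = ≡.cong re (begin
    ι (Σℚ[ 0 , N ] (λ k → sgn k * nℚ (N C k) * (nℚ (2 ℕ.^ k) * nℚ (luc (j ℕ.* k)) * inv (nℚ (luc j ℕ.^ k)))))
      ≡⟨ ≡.cong ι (≡.trans (sumN≡Σ 0 (suc N) _) (Σ-cong′ (suc N) (lucas-summand N))) ⟩
    ι (Σ< (suc N) (λ k → nℚ (N C k) * (t ^ k * nℚ (luc (j ℕ.* k)))))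
      ≡⟨ lucas-binomial-sum N ⟩
    (ι ((- 1ℚ) ^ N) ⊕ ι 1ℚ) ⊗ (u ^₅ N)
      ≡⟨ ≡.cong (λ x → (ι x ⊕ ι 1ℚ) ⊗ (u ^₅ N)) (-1^[1+p+p]≡-1 p) ⟩
    ι 0ℚ ⊗ (u ^₅ N)
      ≡⟨ ⊗-zeroˡ (u ^₅ N) ⟩
    ι 0ℚ ∎)
    where
    N : ℕ
    N = suc (p ℕ.+ p)

  fibonacci-summand : ∀ N k →
    sgn (suc k) * nℚ (N C k) * (nℚ (2 ℕ.^ suc k) * nℚ (fib (j ℕ.* suc k)) * inv (nℚ (suc k) * nℚ (luc j ℕ.^ suc k)))
      ≡ nℚ (N C k) * inv (nℚ (suc k)) * (t ^ suc k * nℚ (fib (j ℕ.* suc k)))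
  fibonacci-summand N k = begin
    sgn (suc k) * nℚ (N C k) * (nℚ (2 ℕ.^ suc k) * nℚ (fib (j ℕ.* suc k)) * inv (nℚ (suc k) * nℚ (luc j ℕ.^ suc k)))
      ≡⟨ ≡.cong (λ x → sgn (suc k) * nℚ (N C k) * (nℚ (2 ℕ.^ suc k) * nℚ (fib (j ℕ.* suc k)) * x))
           (inv-distrib-* (nℚ[1+n]≢0 k) L^≢0) ⟩
    sgn (suc k) * nℚ (N C k) * (nℚ (2 ℕ.^ suc k) * nℚ (fib (j ℕ.* suc k)) * (inv (nℚ (suc k)) * inv (nℚ (luc j ℕ.^ suc k))))
      ≡⟨ solve 6 (λ s c p f i l → s :* c :* (p :* f :* (i :* l)) := c :* i :* (s :* p :* l :* f)) ≡.refl
           (sgn (suc k)) (nℚ (N C k)) (nℚ (2 ℕ.^ suc k)) (nℚ (fib (j ℕ.* suc k))) (inv (nℚ (suc k))) (inv (nℚ (luc j ℕ.^ suc k))) ⟩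
    nℚ (N C k) * inv (nℚ (suc k)) * (sgn (suc k) * nℚ (2 ℕ.^ suc k) * inv (nℚ (luc j ℕ.^ suc k)) * nℚ (fib (j ℕ.* suc k)))
      ≡⟨ ≡.cong (λ x → nℚ (N C k) * inv (nℚ (suc k)) * (x * nℚ (fib (j ℕ.* suc k)))) (sgn*2^/L^≡t^ (suc k)) ⟩
    nℚ (N C k) * inv (nℚ (suc k)) * (t ^ suc k * nℚ (fib (j ℕ.* suc k))) ∎
    where
    L^≢0 : nℚ (luc j ℕ.^ suc k) ≢ 0ℚ
    L^≢0 = ≡.subst (_≢ 0ℚ) (≡.sym (nℚ-^ (luc j) (suc k))) (^-≢0 L≢0 (suc k))

  fibonacci-binomial-sum-even : ∀ p →
    Σ< (suc (suc (suc (p ℕ.+ p)))) (λ i → nℚ (suc (suc (p ℕ.+ p)) C i) * (t ^ i * nℚ (fib (j ℕ.* i)))) ≡ 0ℚ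
  fibonacci-binomial-sum-even p = ≡.cong re (√5-cancelˡ {ι S} {ι 0ℚ} (begin
    √5 ⊗ ι S
      ≡⟨ fibonacci-binomial-sum M ⟩
    (ι ((- 1ℚ) ^ M) ⊖ ι 1ℚ) ⊗ (u ^₅ M)
      ≡⟨ ≡.cong (λ x → (ι x ⊖ ι 1ℚ) ⊗ (u ^₅ M)) (≡.trans (≡.cong (λ i → (- 1ℚ) ^ suc i) (≡.sym (ℕ.+-suc p p))) (-1^[p+p]≡1 (suc p))) ⟩
    ι 0ℚ ⊗ (u ^₅ M)
      ≡⟨ ⊗-zeroˡ (u ^₅ M) ⟩
    ι 0ℚ
      ≡⟨ ⊗-zeroʳ √5 ⟨
    √5 ⊗ ι 0ℚ ∎))
    where
    M : ℕ
    M = suc (suc (p ℕ.+ p))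
    S : ℚ
    S = Σ< (suc M) (λ i → nℚ (M C i) * (t ^ i * nℚ (fib (j ℕ.* i))))

  fibonacci-identity : ∀ {m} p → m ≡ suc (suc (p ℕ.+ p)) →
    Σℚ[ 1 , m ] (λ k → sgn k * nℚ ((m ∸ 1) C (k ∸ 1))
      * (nℚ (2 ℕ.^ k) * nℚ (fib (j ℕ.* k)) * inv (nℚ k * nℚ (luc j ℕ.^ k))))
    ≡ 0ℚ
  fibonacci-identity p ≡.refl = begin
    sumN 1 (suc N) g
      ≡⟨ ≡.trans (sumN≡Σ 1 (suc N) g) (Σ-cong′ (suc N) (fibonacci-summand N)) ⟩
    Σ< (suc N) (λ k → nℚ (N C k) * inv (nℚ (suc k)) * (t ^ suc k * nℚ (fib (j ℕ.* suc k))))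
      ≡⟨ Σ-C/[1+k] N (λ i → t ^ i * nℚ (fib (j ℕ.* i))) (≡.cong (λ i → 1ℚ * nℚ (fib i)) (ℕ.*-zeroʳ j)) ⟩
    inv (nℚ (suc N)) * Σ< (suc (suc N)) (λ i → nℚ (suc N C i) * (t ^ i * nℚ (fib (j ℕ.* i))))
      ≡⟨ ≡.cong (inv (nℚ (suc N)) *_) (fibonacci-binomial-sum-even p) ⟩
    inv (nℚ (suc N)) * 0ℚ
      ≡⟨ ℚ.*-zeroʳ (inv (nℚ (suc N))) ⟩
    0ℚ ∎
    where
    N : ℕ
    N = suc (p ℕ.+ p)
    g : ℕ → ℚ
    g k = sgn k * nℚ (N C (k ∸ 1)) * (nℚ (2 ℕ.^ k) * nℚ (fib (j ℕ.* k)) * inv (nℚ k * nℚ (luc j ℕ.^ k)))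

  lucas-side : ∀ n →
    ι (Σ< (suc n) (λ k → nℚ (n C k) * nℚ (2 ℕ.^ k) * (sgn k * nℚ (luc (j ℕ.* k)) * inv (nℚ (luc j ℕ.^ k)))))
      ⊗ (v ^5 n) ≡ ι (1ℚ + sgn n)
  lucas-side n = begin
    ι (Σ< (suc n) (λ k → nℚ (n C k) * nℚ (2 ℕ.^ k) * (sgn k * nℚ (luc (j ℕ.* k)) * inv (nℚ (luc j ℕ.^ k))))) ⊗ (v ^5 n)
      ≡⟨ ≡.cong (λ x → ι x ⊗ (v ^5 n)) (Σ-cong′ (suc n) (λ k → ≡.trans (regroup k) (lucas-summand n k))) ⟩
    ι (Σ< (suc n) (λ k → nℚ (n C k) * (t ^ k * nℚ (luc (j ℕ.* k))))) ⊗ (v ^5 n)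
      ≡⟨ ≡.cong (_⊗ (v ^5 n)) (lucas-binomial-sum n) ⟩
    (s⊕1 ⊗ (u ^₅ n)) ⊗ (v ^5 n)
      ≡⟨ ≡.trans (⊗-assoc s⊕1 (u ^₅ n) (v ^5 n)) (≡.cong (s⊕1 ⊗_) (u^n⊗v^5n≡1 n)) ⟩
    s⊕1 ⊗ ι 1ℚ
      ≡⟨ ≡.trans (⊗-identityʳ s⊕1) (⊕-comm (ι ((- 1ℚ) ^ n)) (ι 1ℚ)) ⟩
    ι (1ℚ + (- 1ℚ) ^ n)
      ≡⟨ ≡.cong (λ s → ι (1ℚ + s)) (^ℚ≡^ (- 1ℚ) n) ⟨
    ι (1ℚ + sgn n) ∎
    where
    s⊕1 : Q5
    s⊕1 = ι ((- 1ℚ) ^ n) ⊕ ι 1ℚ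
    regroup : ∀ k → nℚ (n C k) * nℚ (2 ℕ.^ k) * (sgn k * nℚ (luc (j ℕ.* k)) * inv (nℚ (luc j ℕ.^ k)))
                  ≡ sgn k * nℚ (n C k) * (nℚ (2 ℕ.^ k) * nℚ (luc (j ℕ.* k)) * inv (nℚ (luc j ℕ.^ k)))
    regroup k = solve 5 (λ c p s l i → c :* p :* (s :* l :* i) := s :* c :* (p :* l :* i)) ≡.refl
      (nℚ (n C k)) (nℚ (2 ℕ.^ k)) (sgn k) (nℚ (luc (j ℕ.* k))) (inv (nℚ (luc j ℕ.^ k)))

  lucas-bernoulli-side : ∀ n → 1 ≤ n →
    Σ< (suc n) (λ k → nℚ (n C k) * nℚ (2 ℕ.^ k) * ((1ℚ + sgn n) * inv (nℚ (n ∸ k ℕ.+ 1)) * bernoulli k)) ≡ 0ℚ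
  lucas-bernoulli-side n 1≤n = begin
    Σ< (suc n) (λ k → nℚ (n C k) * nℚ (2 ℕ.^ k) * ((1ℚ + sgn n) * inv (nℚ (n ∸ k ℕ.+ 1)) * bernoulli k))
      ≡⟨ Σ-cong′ (suc n) (λ k → solve 5 (λ c p s i b → c :* p :* (s :* i :* b) := s :* (c :* p :* i :* b)) ≡.refl
           (nℚ (n C k)) (nℚ (2 ℕ.^ k)) (1ℚ + sgn n) (inv (nℚ (n ∸ k ℕ.+ 1))) (bernoulli k)) ⟩
    Σ< (suc n) (λ k → (1ℚ + sgn n) * S k)
      ≡⟨ *-distribˡ-Σ (suc n) (1ℚ + sgn n) S ⟨
    (1ℚ + sgn n) * Σ< (suc n) S
      ≡⟨ 1+sgn*-cong-even n 1≤n (Σ< (suc n) S) 0ℚ bernoulli-sum-over-[n∸k+1] ⟩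
    (1ℚ + sgn n) * 0ℚ
      ≡⟨ ℚ.*-zeroʳ (1ℚ + sgn n) ⟩
    0ℚ ∎
    where
    S : ℕ → ℚ
    S k = nℚ (n C k) * nℚ (2 ℕ.^ k) * inv (nℚ (n ∸ k ℕ.+ 1)) * bernoulli k

  lucas-bernoulli-identity : ∀ n → 1 ≤ n →
    Σ5[ 0 , n ] (λ k →
        ι (nℚ (n C k) * nℚ (2 ℕ.^ k))
        ⊗ ((ι (sgn k * nℚ (luc (j ℕ.* k)) * inv (nℚ (luc j ℕ.^ k)))
             ⊗ ((ι (nℚ (luc j)) ⊗ inv5 (√5 ⊗ ι (nℚ (fib j)))) ^5 n))
           ⊖ ι ((1ℚ + sgn n) * inv (nℚ (n ∸ k ℕ.+ 1)) * bernoulli k)))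
      ≡ ι (1ℚ + sgn n)
  lucas-bernoulli-identity n 1≤n = begin
    Σ5[ 0 , n ] term
      ≡⟨ ≡.trans (Σ5[0,n]≡Σ₅< n term) (Σ₅-ι-split (suc n) c a d (v ^5 n)) ⟩
    (ι (Σ< (suc n) (λ k → c k * a k)) ⊗ (v ^5 n)) ⊖ ι (Σ< (suc n) (λ k → c k * d k))
      ≡⟨ ≡.cong₂ _⊖_ (lucas-side n) (≡.cong ι (lucas-bernoulli-side n 1≤n)) ⟩
    ι (1ℚ + sgn n) ⊖ ι 0ℚ
      ≡⟨ ≡.cong ι (ℚ.+-identityʳ (1ℚ + sgn n)) ⟩
    ι (1ℚ + sgn n) ∎
    where
    c a d : ℕ → ℚ
    c k = nℚ (n C k) * nℚ (2 ℕ.^ k)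
    a k = sgn k * nℚ (luc (j ℕ.* k)) * inv (nℚ (luc j ℕ.^ k))
    d k = (1ℚ + sgn n) * inv (nℚ (n ∸ k ℕ.+ 1)) * bernoulli k
    term : ℕ → Q5
    term k = ι (c k) ⊗ ((ι (a k) ⊗ (v ^5 n)) ⊖ ι (d k))

  shifted-fibonacci-summand : ∀ n k →
    nℚ (n C k) * nℚ (2 ℕ.^ k) * inv (nℚ (k ℕ.+ 1)) * (sgn k * nℚ (fib (j ℕ.* (k ℕ.+ 1))) * inv (nℚ (luc j ℕ.^ k)))
      ≡ inv t * (nℚ (n C k) * inv (nℚ (suc k)) * (t ^ suc k * nℚ (fib (j ℕ.* suc k))))
  shifted-fibonacci-summand n k = begin
    nℚ (n C k) * nℚ (2 ℕ.^ k) * inv (nℚ (k ℕ.+ 1)) * (sgn k * nℚ (fib (j ℕ.* (k ℕ.+ 1))) * inv (nℚ (luc j ℕ.^ k)))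
      ≡⟨ ≡.cong₂ (λ i f → nℚ (n C k) * nℚ (2 ℕ.^ k) * inv (nℚ i) * (sgn k * nℚ (fib f) * inv (nℚ (luc j ℕ.^ k))))
           (ℕ.+-comm k 1) (≡.cong (j ℕ.*_) (ℕ.+-comm k 1)) ⟩
    nℚ (n C k) * nℚ (2 ℕ.^ k) * inv (nℚ (suc k)) * (sgn k * F′ * inv (nℚ (luc j ℕ.^ k)))
      ≡⟨ solve 6 (λ c p i s f l → c :* p :* i :* (s :* f :* l) := c :* i :* (s :* p :* l :* f)) ≡.refl
           (nℚ (n C k)) (nℚ (2 ℕ.^ k)) (inv (nℚ (suc k))) (sgn k) F′ (inv (nℚ (luc j ℕ.^ k))) ⟩
    nℚ (n C k) * inv (nℚ (suc k)) * (sgn k * nℚ (2 ℕ.^ k) * inv (nℚ (luc j ℕ.^ k)) * F′)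
      ≡⟨ ≡.cong (λ x → nℚ (n C k) * inv (nℚ (suc k)) * (x * F′)) (sgn*2^/L^≡t^ k) ⟩
    nℚ (n C k) * inv (nℚ (suc k)) * (t ^ k * F′)
      ≡⟨ ≡.cong (λ x → nℚ (n C k) * inv (nℚ (suc k)) * x)
           (≡.trans (≡.cong (λ y → y * t ^ k * F′) (inv-inverseˡ t≢0)) (≡.cong (_* F′) (ℚ.*-identityˡ (t ^ k)))) ⟨
    nℚ (n C k) * inv (nℚ (suc k)) * (inv t * t * t ^ k * F′)
      ≡⟨ solve 6 (λ c i it t p f → c :* i :* (it :* t :* p :* f) := it :* (c :* i :* (t :* p :* f))) ≡.refl
           (nℚ (n C k)) (inv (nℚ (suc k))) (inv t) t (t ^ k) F′ ⟩
    inv t * (nℚ (n C k) * inv (nℚ (suc k)) * (t ^ suc k * F′)) ∎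
    where
    F′ : ℚ
    F′ = nℚ (fib (j ℕ.* suc k))

  fibonacci-side-rational : ∀ n →
    inv t * inv (nℚ (suc n)) * (((- 1ℚ) ^ suc n - 1ℚ) * (inv L * F)) ≡ (1ℚ + sgn n) * (F * inv (nℚ 2 * nℚ (suc n)))
  fibonacci-side-rational n = begin
    inv t * inv (nℚ (suc n)) * ((- 1ℚ * s - 1ℚ) * (inv L * F))
      ≡⟨ solve 5 (λ it i s iL f → it :* i :* ((con (- 1ℚ) :* s :- con 1ℚ) :* (iL :* f))
                                := it :* iL :* i :* ((con (- 1ℚ) :* s :- con 1ℚ) :* f)) ≡.refl
           (inv t) (inv (nℚ (suc n))) s (inv L) F ⟩
    inv t * inv L * inv (nℚ (suc n)) * ((- 1ℚ * s - 1ℚ) * F)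
      ≡⟨ ≡.cong (λ x → x * inv (nℚ (suc n)) * ((- 1ℚ * s - 1ℚ) * F)) inv-t*inv-L ⟩
    - inv (nℚ 2) * inv (nℚ (suc n)) * ((- 1ℚ * s - 1ℚ) * F)
      ≡⟨ solve 3 (λ i s f → con (- inv (nℚ 2)) :* i :* ((con (- 1ℚ) :* s :- con 1ℚ) :* f)
                          := (con 1ℚ :+ s) :* (f :* (con (inv (nℚ 2)) :* i))) ≡.refl
           (inv (nℚ (suc n))) s F ⟩
    (1ℚ + s) * (F * (inv (nℚ 2) * inv (nℚ (suc n))))
      ≡⟨ ≡.cong₂ (λ x i → (1ℚ + x) * (F * i)) (^ℚ≡^ (- 1ℚ) n) (inv-distrib-* {nℚ 2} (λ ()) (nℚ[1+n]≢0 n)) ⟨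
    (1ℚ + sgn n) * (F * inv (nℚ 2 * nℚ (suc n))) ∎
    where
    s : ℚ
    s = (- 1ℚ) ^ n

  fibonacci-side : ∀ n →
    ι (Σ< (suc n) (λ k → nℚ (n C k) * nℚ (2 ℕ.^ k) * inv (nℚ (k ℕ.+ 1))
                        * (sgn k * nℚ (fib (j ℕ.* (k ℕ.+ 1))) * inv (nℚ (luc j ℕ.^ k)))))
      ⊗ (v ^5 n) ≡ ι ((1ℚ + sgn n) * (F * inv (nℚ 2 * nℚ (suc n))))
  fibonacci-side n = begin
    ι (Σ< (suc n) (λ k → nℚ (n C k) * nℚ (2 ℕ.^ k) * inv (nℚ (k ℕ.+ 1))
                        * (sgn k * nℚ (fib (j ℕ.* (k ℕ.+ 1))) * inv (nℚ (luc j ℕ.^ k))))) ⊗ (v ^5 n)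
      ≡⟨ ≡.cong (λ x → ι x ⊗ (v ^5 n)) (≡.trans (Σ-cong′ (suc n) (shifted-fibonacci-summand n))
           (≡.trans (≡.sym (*-distribˡ-Σ (suc n) (inv t) _)) (≡.cong (inv t *_) (Σ-C/[1+k] n a a0≡0)))) ⟩
    ι (inv t * (inv (nℚ (suc n)) * S)) ⊗ (v ^5 n)
      ≡⟨ ≡.cong (_⊗ (v ^5 n)) (≡.trans (≡.cong ι (≡.sym (ℚ.*-assoc (inv t) _ S))) (ι-* c S)) ⟩
    (ι c ⊗ ι S) ⊗ (v ^5 n)
      ≡⟨ ≡.cong (λ x → (ι c ⊗ x) ⊗ (v ^5 n)) (fibonacci-binomial-sum-rational n) ⟩
    (ι c ⊗ (ι Y ⊗ (u ^₅ n))) ⊗ (v ^5 n)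
      ≡⟨ ≡.trans (≡.cong (_⊗ (v ^5 n)) (≡.sym (⊗-assoc (ι c) (ι Y) (u ^₅ n)))) (⊗-assoc (ι c ⊗ ι Y) (u ^₅ n) (v ^5 n)) ⟩
    (ι c ⊗ ι Y) ⊗ ((u ^₅ n) ⊗ (v ^5 n))
      ≡⟨ ≡.cong₂ _⊗_ (≡.sym (ι-* c Y)) (u^n⊗v^5n≡1 n) ⟩
    ι (c * Y) ⊗ ι 1ℚ
      ≡⟨ ≡.trans (⊗-identityʳ (ι (c * Y))) (≡.cong ι (fibonacci-side-rational n)) ⟩
    ι ((1ℚ + sgn n) * (F * inv (nℚ 2 * nℚ (suc n)))) ∎
    where
    a : ℕ → ℚ
    a i = t ^ i * nℚ (fib (j ℕ.* i))
    a0≡0 : a 0 ≡ 0ℚ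
    a0≡0 = ≡.cong (λ i → 1ℚ * nℚ (fib i)) (ℕ.*-zeroʳ j)
    S c Y : ℚ
    S = Σ< (suc (suc n)) (λ i → nℚ (suc n C i) * a i)
    c = inv t * inv (nℚ (suc n))
    Y = ((- 1ℚ) ^ suc n - 1ℚ) * (inv L * F)

  fibonacci-bernoulli-side : ∀ n → 1 ≤ n →
    Σ< (suc n) (λ k → nℚ (n C k) * nℚ (2 ℕ.^ k) * inv (nℚ (k ℕ.+ 1))
      * ((1ℚ + sgn n) * ((nℚ (2 ℕ.^ (k ℕ.+ 3)) - nℚ 2) * inv (nℚ (k ℕ.+ 2))) * F * bernoulli (k ℕ.+ 2)))
      ≡ (1ℚ + sgn n) * (F * inv (nℚ 2 * nℚ (suc n)))
  fibonacci-bernoulli-side n 1≤n = begin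
    Σ< (suc n) (λ k → c k * ((1ℚ + sgn n) * x k * F * bernoulli (k ℕ.+ 2)))
      ≡⟨ Σ-cong′ (suc n) (λ k → solve 5 (λ c s x f b → c :* (s :* x :* f :* b) := s :* (f :* (c :* x :* b))) ≡.refl
           (c k) (1ℚ + sgn n) (x k) F (bernoulli (k ℕ.+ 2))) ⟩
    Σ< (suc n) (λ k → (1ℚ + sgn n) * (F * S k))
      ≡⟨ ≡.trans (≡.sym (*-distribˡ-Σ (suc n) (1ℚ + sgn n) (λ k → F * S k))) (≡.cong ((1ℚ + sgn n) *_) (≡.sym (*-distribˡ-Σ (suc n) F S))) ⟩
    (1ℚ + sgn n) * (F * Σ< (suc n) S)
      ≡⟨ 1+sgn*-cong-even n 1≤n _ _ (λ p n≡2+p+p → ≡.cong (F *_) (bernoulli-sum-over-[k+1][k+2] p n≡2+p+p)) ⟩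
    (1ℚ + sgn n) * (F * inv (nℚ 2 * nℚ (suc n))) ∎
    where
    c x S : ℕ → ℚ
    c k = nℚ (n C k) * nℚ (2 ℕ.^ k) * inv (nℚ (k ℕ.+ 1))
    x k = (nℚ (2 ℕ.^ (k ℕ.+ 3)) - nℚ 2) * inv (nℚ (k ℕ.+ 2))
    S k = c k * x k * bernoulli (k ℕ.+ 2)

  fibonacci-bernoulli-identity : ∀ n → 1 ≤ n →
    Σ5[ 0 , n ] (λ k →
        ι (nℚ (n C k) * nℚ (2 ℕ.^ k) * inv (nℚ (k ℕ.+ 1)))
        ⊗ ((ι (sgn k * nℚ (fib (j ℕ.* (k ℕ.+ 1))) * inv (nℚ (luc j ℕ.^ k)))
             ⊗ ((ι (nℚ (luc j)) ⊗ inv5 (√5 ⊗ ι (nℚ (fib j)))) ^5 n))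
           ⊖ ι ((1ℚ + sgn n) * ((nℚ (2 ℕ.^ (k ℕ.+ 3)) - nℚ 2) * inv (nℚ (k ℕ.+ 2)))
                 * nℚ (fib j) * bernoulli (k ℕ.+ 2))))
      ≡ ι 0ℚ
  fibonacci-bernoulli-identity n 1≤n = begin
    Σ5[ 0 , n ] term
      ≡⟨ ≡.trans (Σ5[0,n]≡Σ₅< n term) (Σ₅-ι-split (suc n) c a d (v ^5 n)) ⟩
    (ι (Σ< (suc n) (λ k → c k * a k)) ⊗ (v ^5 n)) ⊖ ι (Σ< (suc n) (λ k → c k * d k))
      ≡⟨ ≡.cong₂ _⊖_ (fibonacci-side n) (≡.cong ι (fibonacci-bernoulli-side n 1≤n)) ⟩
    ι X ⊖ ι X
      ≡⟨ ≡.cong ι (ℚ.+-inverseʳ X) ⟩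
    ι 0ℚ ∎
    where
    c a d : ℕ → ℚ
    c k = nℚ (n C k) * nℚ (2 ℕ.^ k) * inv (nℚ (k ℕ.+ 1))
    a k = sgn k * nℚ (fib (j ℕ.* (k ℕ.+ 1))) * inv (nℚ (luc j ℕ.^ k))
    d k = (1ℚ + sgn n) * ((nℚ (2 ℕ.^ (k ℕ.+ 3)) - nℚ 2) * inv (nℚ (k ℕ.+ 2))) * F * bernoulli (k ℕ.+ 2)
    term : ℕ → Q5
    term k = ι (c k) ⊗ ((ι (a k) ⊗ (v ^5 n)) ⊖ ι (d k))
    X : ℚ
    X = (1ℚ + sgn n) * (F * inv (nℚ 2 * nℚ (suc n)))

2*[1+p]≡2+[p+p] : ∀ p → 2 ℕ.* suc p ≡ suc (suc (p ℕ.+ p))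
2*[1+p]≡2+[p+p] = solve-∀

open Product using (_×_)

theorem4 : (n j : ℕ) → 1 ≤ n → 1 ≤ j →
    (Σ5[ 0 , n ] (λ k →
        ι (nℚ (n C k) * nℚ (2 ℕ.^ k) * inv (nℚ (k ℕ.+ 1)))
        ⊗ ((ι (sgn k * nℚ (fib (j ℕ.* (k ℕ.+ 1))) * inv (nℚ (luc j ℕ.^ k)))
             ⊗ ((ι (nℚ (luc j)) ⊗ inv5 (√5 ⊗ ι (nℚ (fib j)))) ^5 n))
           ⊖ ι ((1ℚ + sgn n) * ((nℚ (2 ℕ.^ (k ℕ.+ 3)) - nℚ 2) * inv (nℚ (k ℕ.+ 2)))
                 * nℚ (fib j) * bernoulli (k ℕ.+ 2))))
      ≡ ι 0ℚ)
    × (Σℚ[ 1 , 2 ℕ.* n ] (λ k →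
        sgn k * nℚ ((2 ℕ.* n ∸ 1) C (k ∸ 1))
        * (nℚ (2 ℕ.^ k) * nℚ (fib (j ℕ.* k)) * inv (nℚ k * nℚ (luc j ℕ.^ k))))
      ≡ 0ℚ)
    × (Σ5[ 0 , n ] (λ k →
        ι (nℚ (n C k) * nℚ (2 ℕ.^ k))
        ⊗ ((ι (sgn k * nℚ (luc (j ℕ.* k)) * inv (nℚ (luc j ℕ.^ k)))
             ⊗ ((ι (nℚ (luc j)) ⊗ inv5 (√5 ⊗ ι (nℚ (fib j)))) ^5 n))
           ⊖ ι ((1ℚ + sgn n) * inv (nℚ (n ∸ k ℕ.+ 1)) * bernoulli k)))
      ≡ ι (1ℚ + sgn n))
    × (Σℚ[ 0 , 2 ℕ.* n ∸ 1 ] (λ k →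
        sgn k * nℚ ((2 ℕ.* n ∸ 1) C k)
        * (nℚ (2 ℕ.^ k) * nℚ (luc (j ℕ.* k)) * inv (nℚ (luc j ℕ.^ k))))
      ≡ 0ℚ)
theorem4 (suc p) j 1≤n 1≤j =
    fibonacci-bernoulli-identity (suc p) 1≤n
  , fibonacci-identity p (2*[1+p]≡2+[p+p] p)
  , lucas-bernoulli-identity (suc p) 1≤n
  , lucas-identity p (2*[1+p]≡2+[p+p] p)
  where open FibonacciLucasBernoulliIdentities j 1≤j
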